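{- Let $s=(g_1,\dots,g_J)$ be an admissible constellation of length $J$, and let $Q(s)$ be the product of all odd primes dividing some span $\sigma_j-\sigma_i$ with $0\le i<j\le J$. Then for every prime $p$, $$\sum_{j\ge J} n_{s,j}(p^\#)=\prod_{q\le p}(q-\nu_q(s)),$$ and, setting $w_{s,J}(p^\#)=n_{s,J}(p^\#)\big/\prod_{J+1<q\le p}(q-J-1)$, the limit $w_{s,J}(\infty)=\lim_{p\to\infty}w_{s,J}(p^\#)$ exists and equals $$w_{s,J}(\infty)=\prod_{q\le J+1}(q-\nu_q(s))\cdot\prod_{\substack{q>J+1\\ q\mid Q(s)}}\frac{q-\nu_q(s)}{q-J-1},$$ so that $n_{s,J}(p^\#)$ is asymptotic to $w_{s,J}(\infty)\prod_{J+1<q\le p}(q-J-1)$. (All products are over primes $q$.)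
   Context: For a prime $p$, $p^\#$ is the product of all primes $\le p$, and $\mathcal{G}(p^\#)$ is the cyclic sequence of gaps between consecutive integers coprime to $p^\#$ over one period (positions identified with residues mod $p^\#$ coprime to $p^\#$). A constellation of length $J$ is a sequence $s=(g_1,\dots,g_J)$ of positive integers; $\sigma_0=0$, $\sigma_j=g_1+\dots+g_j$. For a prime $q$, $\nu_q(s)$ is the number of distinct residues $\sigma_j \bmod q$, $0\le j\le J$; $s$ is admissible for $q$ iff $\nu_q(s)<q$, and admissible iff admissible for every prime $q$. An occurrence in $\mathcal{G}(p^\#)$ of $s$ or a driving term for $s$ is a residue $\gamma_0 \bmod p^\#$ with $\gamma_0+\sigma_j$ coprime to $p^\#$ for all $0\le j\le J$; it is a driving term of length $j\ge J$ if exactly $j-J$ integers strictly between $\gamma_0$ and $\gamma_0+\sigma_J$, other than the $\gamma_0+\sigma_i$, are coprime to $p^\#$ (length $J$ means an occurrence of $s$ itself). $n_{s,j}(p^\#)$ denotes the number of occurrences in $\mathcal{G}(p^\#)$ of driving terms of length $j$ for $s$ (with $n_{s,J}(p^\#)$ the number of occurrences of $s$ itself). -}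

module Defs where

open import Data.Nat using (ℕ; zero; suc; _+_; _*_; _∸_; _<_; _<?_; _≟_)
open import Data.Nat.DivMod using (_%_)
open import Data.Nat.Primality using (Prime; prime?)
open import Data.Nat.Coprimality using (Coprime; coprime?)
open import Data.Nat.Divisibility using (_∣_; _∣?_)
open import Data.List using (List; []; _∷_; length; filter; map; upTo; scanl; _++_)
open import Data.Nat.ListAction using (sum; product)
open import Data.List.Relation.Unary.All using (All; all?)
open import Data.List.Relation.Unary.Any using (Any; any?)
open import Data.List.Membership.DecPropositional _≟_ using (_∈_; _∈?_)
open import Data.Product using (_×_)
open import Relation.Nullary using (¬_; _×-dec_; ¬?)
open import Relation.Binary.PropositionalEquality using (_≡_)
open import Data.Integer using (+_)
open import Data.Rational using (ℚ; _/_; 0ℚ)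

-- A constellation s = (g₁,…,g_J) is a list of naturals; J = length s.
-- σ₀ = 0, σ_j = g₁+…+g_j : the list (σ₀, …, σ_J).
sigmas : List ℕ → List ℕ
sigmas s = scanl _+_ 0 s

sigmaJ : List ℕ → ℕ
sigmaJ s = sum s

-- ν_q(s) : number of distinct residues σ_j mod q (0 ≤ j ≤ J); junk 0 for q = 0.
nu : ℕ → List ℕ → ℕ
nu zero s = 0
nu (suc k) s =
  length (filter (λ r → any? (λ σ → (σ % suc k) ≟ r) (sigmas s)) (upTo (suc k)))

Admissible : List ℕ → Set
Admissible s = (q : ℕ) → Prime q → nu q s < q

primesUpTo : ℕ → List ℕ
primesUpTo p = filter prime? (upTo (suc p))

primorial : ℕ → ℕ
primorial p = product (primesUpTo p)

extra : ℕ → List ℕ → ℕ → ℕ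
extra p s γ =
  length (filter (λ k → (0 <? k) ×-dec (¬? (k ∈? sigmas s)) ×-dec coprime? (γ + k) (primorial p))
                 (upTo (sigmaJ s)))

-- n_{s,j}(p#) : number of residues γ₀ mod p# (γ₀ ∈ [0, p#)) giving an
-- occurrence of a driving term of length j for s
nsj : List ℕ → ℕ → ℕ → ℕ
nsj s j p =
  length (filter (λ γ → all? (λ σ → coprime? (γ + σ) (primorial p)) (sigmas s)
                         ×-dec (length s + extra p s γ ≟ j))
                 (upTo (primorial p)))

-- Σ_{j ≥ J} n_{s,j}(p#); the terms with j > J + σ_J vanish (extra < σ_J),
-- so the sum is taken over J ≤ j ≤ J + σ_J.
sumDriving : List ℕ → ℕ → ℕ
sumDriving s p = sum (map (λ i → nsj s (length s + i) p) (upTo (suc (sigmaJ s))))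

-- spans σ_j − σ_i, 0 ≤ i < j ≤ J (the σ's are nondecreasing)
spansOf : List ℕ → List ℕ
spansOf [] = []
spansOf (x ∷ xs) = map (λ y → y ∸ x) xs ++ spansOf xs

spans : List ℕ → List ℕ
spans s = spansOf (sigmas s)

-- Q(s) : product of the odd primes dividing some span; all spans are ≤ σ_J
-- (and positive for positive gaps), so such primes are ≤ σ_J.
Qs : List ℕ → ℕ
Qs s = product (filter (λ q → prime? q ×-dec ¬? (q ≟ 2) ×-dec any? (λ d → q ∣? d) (spans s))
                       (upTo (suc (sigmaJ s))))

-- n / d as a rational (junk value 0 when d = 0; never used with d = 0)
frac : ℕ → ℕ → ℚ
frac n zero = 0ℚ
frac n (suc d) = + n / suc d

denomP : List ℕ → ℕ → ℕ
denomP s p = product (map (λ q → q ∸ suc (length s))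
                          (filter (λ q → suc (length s) <? q) (primesUpTo p)))

wsJ : List ℕ → ℕ → ℚ
wsJ s p = frac (nsj s (length s) p) (denomP s p)

bigQPrimes : List ℕ → List ℕ
bigQPrimes s = filter (λ q → (suc (length s) <? q) ×-dec (q ∣? Qs s)) (primesUpTo (Qs s))

wInf : List ℕ → ℚ
wInf s = frac (product (map (λ q → q ∸ nu q s) (primesUpTo (suc (length s))))
               * product (map (λ q → q ∸ nu q s) (bigQPrimes s)))
              (product (map (λ q → q ∸ suc (length s)) (bigQPrimes s)))

-- For a list L of shifts, the γ < p# with every γ + σ (σ ∈ L) coprime to p# are counted prime by prime
-- (Chinese remainder theorem): the prime q leaves q − ν_q(L) admissible residues. Every such γ for
-- L = (σ₀, …, σ_J) is a driving term for s of exactly one length, which gives the first claim.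
--
-- The same count, with T the number of such γ, shows w_{s,J}(∞) = T / ∏_{J+1<q≤p} (q − J − 1) once p ≥ σ_J,
-- because every prime q > J + 1 not dividing Q(s) has ν_q(s) = J + 1. The occurrences of s itself are the γ
-- without a further coprime number between γ and γ + σ_J, so T − n_{s,J} is at most the number of occurrences
-- of the σ_J longer patterns k ∷ L. Primes q > σ_J leave these q − J − 2 residues instead of q − J − 1, hence
-- T − n_{s,J} ≤ σ_J · T · ∏_{σ_J<q≤p} (1 − 1/q), and the product tends to 0 by Euler's bound
-- ∏_{q≤p} q/(q − 1) ≥ ∑_{n≤p} 1/n.

module Submission where

open import Defs
open import Level using (0ℓ)
open import Data.Bool using (Bool; true; false; if_then_else_; _∧_; not)
open import Data.Bool.Properties using (∧-assoc; ∧-identityʳ)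
open import Data.Empty using (⊥; ⊥-elim)
open import Data.Nat using (ℕ; zero; suc; _+_; _*_; _∸_; _^_; _<_; _≤_; _≟_; z≤n; s≤s; _<?_; _≤?_; NonZero; >-nonZero; nonTrivial⇒n>1; nonTrivial⇒≢1)
open import Data.Nat.Properties
open import Data.Nat.DivMod using (_%_; _/_; m≡m%n+[m/n]*n; m%n<n; m<n⇒m%n≡m; n%n≡0; m<n⇒m/n≡0; m*n/n≡m; +-distrib-/-∣ʳ; m/n*n≤m; /-monoˡ-≤; m/n/o≡m/[n*o]; m≥n⇒m/n>0; m/n<m; n/1≡n)
open import Data.Nat.Divisibility using (_∣_; _∣?_; divides; ∣-trans; ∣m+n∣m⇒∣n; ∣m∣n⇒∣m+n; ∣m⇒∣m*n; ∣n⇒∣m*n; n∣m*n; ∣⇒≤; _∣0; 0∣⇒≡0; ∣-refl; ∣1⇒≡1)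
open import Data.Nat.Primality using (Prime; prime?; euclidsLemma; prime⇒irreducible; prime⇒nonTrivial)
open import Data.Nat.Primality.Factorisation using (factorise)
open import Data.Nat.Coprimality using (Coprime; coprime?; 1-coprimeTo)
import Data.Nat.Coprimality as Coprimality
open import Data.Nat.ListAction using (sum; product)
open import Data.Nat.ListAction.Properties using (sum-++; product-++)
open import Data.Nat.Solver using (module +-*-Solver)
open import Data.Integer as ℤ using (+[1+_])
import Data.Integer
open import Data.Integer.Properties as ℤP using (pos-*; m-n≡m⊖n; ⊖-≤)
open import Data.Rational as ℚ using (ℚ; mkℚ; 0ℚ; toℚᵘ; fromℚᵘ; ∣_∣; _-_; positive) renaming (_<_ to _<ℚ_)
open import Data.Rational.Properties using (toℚᵘ-cancel-<; toℚᵘ-homo-∣-∣; toℚᵘ-homo-+; toℚᵘ-homo‿-; toℚᵘ-fromℚᵘ)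
open import Data.Rational.Unnormalised as ℚᵘ using (ℚᵘ; mkℚᵘ; *<*)
open import Data.Rational.Unnormalised.Properties using (≃-sym; ≃-trans; <-respˡ-≃; ∣-∣-cong; +-cong; -‿cong)
open import Data.List using (List; []; _∷_; [_]; length; filter; map; upTo; scanl; _++_)
open import Data.List.Properties using (filter-++; map-++; length-++; upTo-∷ʳ; map-id; length-filter; length-upTo)
open import Data.List.Relation.Unary.All as All using (All; []; _∷_; all?)
open import Data.List.Relation.Unary.AllPairs as AllPairs using (AllPairs; []; _∷_)
open import Data.List.Relation.Unary.All.Properties using (All¬⇒¬Any; ¬Any⇒All¬)
open import Data.List.Relation.Unary.Any as Any using (here; there; any?)
open import Data.List.Membership.DecPropositional _≟_ using (_∈_; _∈?_)
open import Data.List.Membership.Propositional.Properties using (∈-++⁺ˡ; ∈-++⁺ʳ; ∈-++⁻; ∈-map⁻)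
open import Data.Product using (_×_; _,_; proj₁; proj₂; ∃-syntax)
open import Data.Sum using (_⊎_; inj₁; inj₂)
open import Relation.Nullary using (Dec; yes; no; does; ¬_; _×-dec_; ¬?; contradiction)
open import Relation.Nullary.Decidable using (dec-true; dec-false)
open import Relation.Unary using (Pred; Decidable)
open import Relation.Binary.PropositionalEquality hiding ([_]; J)
open import Function using (_∘_)
open +-*-Solver

does≡true⇒ : ∀ {a} {A : Set a} (d : Dec A) → does d ≡ true → A
does≡true⇒ (yes a) _ = a
does≡true⇒ (no _) ()

does≡false⇒ : ∀ {a} {A : Set a} (d : Dec A) → does d ≡ false → ¬ A
does≡false⇒ (yes _) ()
does≡false⇒ (no na) _ = na

∧≡true⇒ : ∀ {a b} → a ∧ b ≡ true → a ≡ true × b ≡ true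
∧≡true⇒ {true} {true} _ = refl , refl

not≡true⇒ : ∀ {a} → not a ≡ true → a ≡ false
not≡true⇒ {false} _ = refl

χ : ∀ {a} {A : Set a} → Dec A → ℕ
χ (yes _) = 1
χ (no _) = 0

χ-cong : ∀ {a b} {A : Set a} {B : Set b} → (A → B) → (B → A) → (x : Dec A) (y : Dec B) → χ x ≡ χ y
χ-cong f g (yes _) (yes _) = refl
χ-cong f g (yes a) (no nb) = ⊥-elim (nb (f a))
χ-cong f g (no na) (yes b) = ⊥-elim (na (g b))
χ-cong f g (no _) (no _) = refl

χ-× : ∀ {a b} {A : Set a} {B : Set b} (x : Dec A) (y : Dec B) → χ (x ×-dec y) ≡ χ x * χ y
χ-× (yes _) (yes _) = refl
χ-× (yes _) (no _) = refl
χ-× (no _) (yes _) = refl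
χ-× (no _) (no _) = refl

χ≤1 : ∀ {a} {A : Set a} (x : Dec A) → χ x ≤ 1
χ≤1 (yes _) = s≤s z≤n
χ≤1 (no _) = z≤n

χ-yes : ∀ {a} {A : Set a} (x : Dec A) → A → χ x ≡ 1
χ-yes (yes _) _ = refl
χ-yes (no n) a = ⊥-elim (n a)

χ-no : ∀ {a} {A : Set a} (x : Dec A) → ¬ A → χ x ≡ 0
χ-no (yes a) n = ⊥-elim (n a)
χ-no (no _) _ = refl

χ-¬ : ∀ {a} {A : Set a} (d : Dec A) → χ (¬? d) ≡ 1 ∸ χ d
χ-¬ (yes _) = refl
χ-¬ (no _) = refl

-- Finite sums and products over ranges

∑ : ℕ → (ℕ → ℕ) → ℕ
∑ zero f = 0
∑ (suc n) f = ∑ n f + f n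
infix 5 ∑
syntax ∑ n (λ i → e) = ∑[ i < n ] e

∑-cong : ∀ n {f g : ℕ → ℕ} → (∀ i → i < n → f i ≡ g i) → ∑ n f ≡ ∑ n g
∑-cong zero h = refl
∑-cong (suc n) h = cong₂ _+_ (∑-cong n (λ i i<n → h i (m<n⇒m<1+n i<n))) (h n ≤-refl)

∑-mono-≤ : ∀ n {f g : ℕ → ℕ} → (∀ i → i < n → f i ≤ g i) → ∑ n f ≤ ∑ n g
∑-mono-≤ zero h = z≤n
∑-mono-≤ (suc n) h = +-mono-≤ (∑-mono-≤ n (λ i i<n → h i (m<n⇒m<1+n i<n))) (h n ≤-refl)

∑-distrib-+ : ∀ n (f g : ℕ → ℕ) → ∑[ i < n ] f i + g i ≡ ∑ n f + ∑ n g
∑-distrib-+ zero f g = refl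
∑-distrib-+ (suc n) f g rewrite ∑-distrib-+ n f g =
  solve 4 (λ a b c d → a :+ b :+ (c :+ d) := a :+ c :+ (b :+ d)) refl (∑ n f) (∑ n g) (f n) (g n)

∑-*ˡ : ∀ n c (f : ℕ → ℕ) → ∑[ i < n ] c * f i ≡ c * ∑ n f
∑-*ˡ zero c f = sym (*-zeroʳ c)
∑-*ˡ (suc n) c f rewrite ∑-*ˡ n c f = sym (*-distribˡ-+ c (∑ n f) (f n))

∑-*ʳ : ∀ n c (f : ℕ → ℕ) → ∑[ i < n ] f i * c ≡ ∑ n f * c
∑-*ʳ n c f = trans (∑-cong n (λ i _ → *-comm (f i) c)) (trans (∑-*ˡ n c f) (*-comm c (∑ n f)))

∑-zero : ∀ n → ∑[ _ < n ] 0 ≡ 0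
∑-zero zero = refl
∑-zero (suc n) rewrite ∑-zero n = refl

∑-const : ∀ n c → ∑[ _ < n ] c ≡ n * c
∑-const zero c = refl
∑-const (suc n) c rewrite ∑-const n c = +-comm (n * c) c

∑-comm : ∀ n m (g : ℕ → ℕ → ℕ) → ∑[ i < n ] ∑[ j < m ] g i j ≡ ∑[ j < m ] ∑[ i < n ] g i j
∑-comm zero m g = sym (∑-zero m)
∑-comm (suc n) m g rewrite ∑-comm n m g = sym (∑-distrib-+ m (λ j → ∑[ i < n ] g i j) (λ j → g n j))

∑-+-range : ∀ a b (f : ℕ → ℕ) → ∑ (a + b) f ≡ ∑ a f + (∑[ i < b ] f (a + i))
∑-+-range a zero f rewrite +-identityʳ a = sym (+-identityʳ _)
∑-+-range a (suc b) f rewrite +-suc a b | ∑-+-range a b f = +-assoc (∑ a f) _ (f (a + b))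

∑-*-range : ∀ q m (g : ℕ → ℕ) → ∑ (q * m) g ≡ ∑[ y < q ] ∑[ x < m ] g (y * m + x)
∑-*-range zero m g = refl
∑-*-range (suc q) m g = trans (cong (λ k → ∑ k g) (+-comm m (q * m))) (trans (∑-+-range (q * m) m g) (cong (_+ (∑[ x < m ] g (q * m + x))) (∑-*-range q m g)))

∑-χ≟ : ∀ n a (f : ℕ → ℕ) → a < n → ∑[ r < n ] χ (a ≟ r) * f r ≡ f a
∑-χ≟ zero a f ()
∑-χ≟ (suc n) a f a<sn with a ≟ n
... | yes refl = trans (cong (_+ (f a + 0)) (trans (∑-cong a (λ r r<a → cong (_* f r) (χ-no (a ≟ r) (λ e → <-irrefl (sym e) r<a)))) (∑-zero a))) (+-identityʳ (f a))
... | no a≢n = trans (+-identityʳ _) (∑-χ≟ n a f (≤∧≢⇒< (≤-pred a<sn) a≢n))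

∑-≤1⇒≤n : ∀ n (c : ℕ → ℕ) → (∀ i → i < n → c i ≤ 1) → ∑ n c ≤ n
∑-≤1⇒≤n zero c h = z≤n
∑-≤1⇒≤n (suc n) c h = subst (∑ n c + c n ≤_) (+-comm n 1) (+-mono-≤ (∑-≤1⇒≤n n c (λ i i<n → h i (m<n⇒m<1+n i<n))) (h n ≤-refl))

∑-1∸ : ∀ n (c : ℕ → ℕ) → (∀ i → i < n → c i ≤ 1) → ∑[ i < n ] 1 ∸ c i ≡ n ∸ ∑ n c
∑-1∸ zero c h = refl
∑-1∸ (suc n) c h rewrite ∑-1∸ n c (λ i i<n → h i (m<n⇒m<1+n i<n)) = ∸-step (∑-≤1⇒≤n n c (λ i i<n → h i (m<n⇒m<1+n i<n))) (h n ≤-refl)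
  where
  ∸-step : ∀ {s x} → s ≤ n → x ≤ 1 → n ∸ s + (1 ∸ x) ≡ suc n ∸ (s + x)
  ∸-step {s} {zero} s≤n _ rewrite +-identityʳ s = trans (+-comm (n ∸ s) 1) (sym (+-∸-assoc 1 s≤n))
  ∸-step {s} {suc zero} s≤n _ rewrite +-identityʳ (n ∸ s) | +-comm s 1 = refl
  ∸-step {s} {suc (suc x)} _ (s≤s ())

∑-≤1≡n⇒≡1 : ∀ m (c : ℕ → ℕ) → (∀ r → c r ≤ 1) → ∑ m c ≡ m → ∀ r → r < m → c r ≡ 1
∑-≤1≡n⇒≡1 zero _ _ _ _ ()
∑-≤1≡n⇒≡1 (suc m) c c≤1 e r r<1+m with r ≟ m
... | yes refl = cm≡1
  where
  cm≡1 : c r ≡ 1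
  cm≡1 = ≤-antisym (c≤1 r) (+-cancelˡ-≤ r 1 (c r) (begin
      r + 1            ≡⟨ trans (+-comm r 1) (sym e) ⟩
      ∑ r c + c r      ≤⟨ +-monoˡ-≤ (c r) (∑-≤1⇒≤n r c (λ i _ → c≤1 i)) ⟩
      r + c r          ∎))
    where open ≤-Reasoning
... | no r≢m = ∑-≤1≡n⇒≡1 m c c≤1 ∑≡m r (≤∧≢⇒< (≤-pred r<1+m) r≢m)
  where
  ∑≡m : ∑ m c ≡ m
  ∑≡m = ≤-antisym (∑-≤1⇒≤n m c (λ i _ → c≤1 i)) (+-cancelʳ-≤ (c m) m (∑ m c) (begin
      m + c m          ≤⟨ +-monoʳ-≤ m (c≤1 m) ⟩
      m + 1            ≡⟨ trans (+-comm m 1) (sym e) ⟩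
      ∑ m c + c m      ∎))
    where open ≤-Reasoning

module _ (n : ℕ) (h : ℕ → ℕ) (h<n : ∀ y → y < n → h y < n) (h-injective : ∀ y y' → y < n → y' < n → h y ≡ h y' → y ≡ y') where

  private
    fibre-size : ∀ k r → k ≤ n → (∑[ y < k ] χ (h y ≟ r) ≡ 0) ⊎ (∑[ y < k ] χ (h y ≟ r) ≡ 1 × ∃[ y ] (y < k × h y ≡ r))
    fibre-size zero r _ = inj₁ refl
    fibre-size (suc k) r 1+k≤n with fibre-size k r (≤-trans (n≤1+n k) 1+k≤n) | h k ≟ r
    ... | inj₁ e | yes hk≡r rewrite e = inj₂ (refl , k , ≤-refl , hk≡r)
    ... | inj₁ e | no _ rewrite e = inj₁ refl
    ... | inj₂ (e , y , y<k , hy≡r) | yes hk≡r = ⊥-elim (<-irrefl (h-injective y k (<-trans y<k 1+k≤n) 1+k≤n (trans hy≡r (sym hk≡r))) y<k)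
    ... | inj₂ (e , y , y<k , hy≡r) | no _ rewrite e = inj₂ (refl , y , m<n⇒m<1+n y<k , hy≡r)

    fibre-size≤1 : ∀ r → ∑[ y < n ] χ (h y ≟ r) ≤ 1
    fibre-size≤1 r with fibre-size n r ≤-refl
    ... | inj₁ e rewrite e = z≤n
    ... | inj₂ (e , _) rewrite e = ≤-refl

    ∑-fibre-sizes : ∑[ r < n ] ∑[ y < n ] χ (h y ≟ r) ≡ n
    ∑-fibre-sizes = begin
        ∑[ r < n ] ∑[ y < n ] χ (h y ≟ r)        ≡⟨ ∑-comm n n (λ r y → χ (h y ≟ r)) ⟩
        ∑[ y < n ] ∑[ r < n ] χ (h y ≟ r)        ≡⟨ ∑-cong n (λ y _ → ∑-cong n (λ r _ → sym (*-identityʳ _))) ⟩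
        ∑[ y < n ] ∑[ r < n ] χ (h y ≟ r) * 1    ≡⟨ ∑-cong n (λ y y<n → ∑-χ≟ n (h y) (λ _ → 1) (h<n y y<n)) ⟩
        ∑[ y < n ] 1                             ≡⟨ trans (∑-const n 1) (*-identityʳ n) ⟩
        n                                        ∎
      where open ≡-Reasoning

  -- Each r < n has exactly one preimage, since the fibre sizes are at most 1 and add up to n.
  ∑-reindex : ∀ (f : ℕ → ℕ) → ∑[ y < n ] f (h y) ≡ ∑ n f
  ∑-reindex f = begin
      ∑[ y < n ] f (h y)                          ≡⟨ ∑-cong n (λ y y<n → sym (∑-χ≟ n (h y) f (h<n y y<n))) ⟩
      ∑[ y < n ] ∑[ r < n ] χ (h y ≟ r) * f r     ≡⟨ ∑-comm n n (λ y r → χ (h y ≟ r) * f r) ⟩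
      ∑[ r < n ] ∑[ y < n ] χ (h y ≟ r) * f r     ≡⟨ ∑-cong n (λ r _ → ∑-*ʳ n (f r) (λ y → χ (h y ≟ r))) ⟩
      ∑[ r < n ] (∑[ y < n ] χ (h y ≟ r)) * f r   ≡⟨ ∑-cong n (λ r r<n → trans (cong (_* f r) (one-preimage r r<n)) (*-identityˡ (f r))) ⟩
      ∑ n f                                       ∎
    where
    open ≡-Reasoning
    one-preimage : ∀ r → r < n → ∑[ y < n ] χ (h y ≟ r) ≡ 1
    one-preimage = ∑-≤1≡n⇒≡1 n (λ r → ∑[ y < n ] χ (h y ≟ r)) fibre-size≤1 ∑-fibre-sizes

∏ : ℕ → (ℕ → Bool) → (ℕ → ℕ) → ℕ
∏ zero b f = 1
∏ (suc n) b f = ∏ n b f * (if b n then f n else 1)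

∏-cong : ∀ n {b b' : ℕ → Bool} {f g : ℕ → ℕ} → (∀ i → i < n → b i ≡ b' i) → (∀ i → i < n → b i ≡ true → f i ≡ g i) → ∏ n b f ≡ ∏ n b' g
∏-cong zero hb hf = refl
∏-cong (suc n) {b} {b'} {f} {g} hb hf = cong₂ _*_ (∏-cong n (λ i i<n → hb i (m<n⇒m<1+n i<n)) (λ i i<n → hf i (m<n⇒m<1+n i<n))) (last-factor≡ (b n) (b' n) (hb n ≤-refl) (hf n ≤-refl))
  where
  last-factor≡ : ∀ x y → x ≡ y → (x ≡ true → f n ≡ g n) → (if x then f n else 1) ≡ (if y then g n else 1)
  last-factor≡ true .true refl h = h refl
  last-factor≡ false .false refl h = refl

∏-mono-≤ : ∀ n (b : ℕ → Bool) {f g : ℕ → ℕ} → (∀ i → i < n → b i ≡ true → f i ≤ g i) → ∏ n b f ≤ ∏ n b g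
∏-mono-≤ zero b h = ≤-refl
∏-mono-≤ (suc n) b {f} {g} h = *-mono-≤ (∏-mono-≤ n b (λ i i<n → h i (m<n⇒m<1+n i<n))) (last-factor≤ (b n) (h n ≤-refl))
  where
  last-factor≤ : ∀ x → (x ≡ true → f n ≤ g n) → (if x then f n else 1) ≤ (if x then g n else 1)
  last-factor≤ true h = h refl
  last-factor≤ false h = ≤-refl

∏-distrib-* : ∀ n (b : ℕ → Bool) (f g : ℕ → ℕ) → ∏ n b (λ i → f i * g i) ≡ ∏ n b f * ∏ n b g
∏-distrib-* zero b f g = refl
∏-distrib-* (suc n) b f g rewrite ∏-distrib-* n b f g with b n
... | true = solve 4 (λ a b c d → a :* b :* (c :* d) := a :* c :* (b :* d)) refl (∏ n b f) (∏ n b g) (f n) (g n)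
... | false = solve 2 (λ a b → a :* b :* con 1 := a :* con 1 :* (b :* con 1)) refl (∏ n b f) (∏ n b g)

∏-split : ∀ n (b c : ℕ → Bool) (f : ℕ → ℕ) → ∏ n b f ≡ ∏ n (λ i → b i ∧ c i) f * ∏ n (λ i → b i ∧ not (c i)) f
∏-split zero b c f = refl
∏-split (suc n) b c f rewrite ∏-split n b c f with b n | c n
... | true | true = solve 3 (λ u v x → u :* v :* x := u :* x :* (v :* con 1)) refl B C (f n)
  where B = ∏ n (λ i → b i ∧ c i) f ; C = ∏ n (λ i → b i ∧ not (c i)) f
... | true | false = solve 3 (λ u v x → u :* v :* x := u :* con 1 :* (v :* x)) refl B C (f n)
  where B = ∏ n (λ i → b i ∧ c i) f ; C = ∏ n (λ i → b i ∧ not (c i)) f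
... | false | _ = solve 2 (λ u v → u :* v :* con 1 := u :* con 1 :* (v :* con 1)) refl B C
  where B = ∏ n (λ i → b i ∧ c i) f ; C = ∏ n (λ i → b i ∧ not (c i)) f

∏-positive : ∀ n (b : ℕ → Bool) (f : ℕ → ℕ) → (∀ i → b i ≡ true → 1 ≤ f i) → 1 ≤ ∏ n b f
∏-positive zero b f h = ≤-refl
∏-positive (suc n) b f h = *-mono-≤ {1} {_} {1} (∏-positive n b f h) (last-factor≥1 (b n) (h n))
  where
  last-factor≥1 : ∀ x → (x ≡ true → 1 ≤ f n) → 1 ≤ (if x then f n else 1)
  last-factor≥1 true h = h refl
  last-factor≥1 false h = ≤-refl

∏-extend-by : ∀ k a (b : ℕ → Bool) (f : ℕ → ℕ) → (∀ i → b i ≡ true → i < a) → ∏ (a + k) b f ≡ ∏ a b f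
∏-extend-by zero a b f h rewrite +-identityʳ a = refl
∏-extend-by (suc k) a b f h rewrite +-suc a k | ∏-extend-by k a b f h with b (a + k) in eq
... | true = ⊥-elim (<-irrefl refl (≤-trans (h (a + k) eq) (m≤m+n a k)))
... | false = *-identityʳ _

∏-extend : ∀ a n (b : ℕ → Bool) (f : ℕ → ℕ) → (∀ i → b i ≡ true → i < a) → a ≤ n → ∏ n b f ≡ ∏ a b f
∏-extend a n b f h a≤n = trans (cong (λ k → ∏ k b f) (sym (m+[n∸m]≡n a≤n))) (∏-extend-by (n ∸ a) a b f h)

∏-range-irrelevant : ∀ n₁ n₂ (b : ℕ → Bool) (f : ℕ → ℕ) → (∀ i → b i ≡ true → i < n₁) → (∀ i → b i ≡ true → i < n₂) → ∏ n₁ b f ≡ ∏ n₂ b f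
∏-range-irrelevant n₁ n₂ b f h₁ h₂ with ≤-total n₁ n₂
... | inj₁ le = sym (∏-extend n₁ n₂ b f h₁ le)
... | inj₂ le = ∏-extend n₂ n₁ b f h₂ le

sum-map-upTo : ∀ (f : ℕ → ℕ) n → sum (map f (upTo n)) ≡ ∑ n f
sum-map-upTo f zero = refl
sum-map-upTo f (suc n) rewrite sym (cong (sum ∘ map f) (upTo-∷ʳ n)) | map-++ f (upTo n) [ n ] | sum-++ (map f (upTo n)) [ f n ] | sum-map-upTo f n = cong (∑ n f +_) (+-identityʳ (f n))

module _ {P : Pred ℕ 0ℓ} (P? : Decidable P) where

  filter-upTo-suc : ∀ n → filter P? (upTo (suc n)) ≡ filter P? (upTo n) ++ filter P? [ n ]
  filter-upTo-suc n = trans (cong (filter P?) (sym (upTo-∷ʳ n))) (filter-++ P? (upTo n) [ n ])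

  length-filter-upTo : ∀ n → length (filter P? (upTo n)) ≡ ∑[ i < n ] χ (P? i)
  length-filter-upTo zero = refl
  length-filter-upTo (suc n) rewrite filter-upTo-suc n | length-++ (filter P? (upTo n)) {filter P? [ n ]} | length-filter-upTo n with P? n
  ... | yes _ = refl
  ... | no _ = refl

  product-filter-upTo : ∀ (f : ℕ → ℕ) n → product (map f (filter P? (upTo n))) ≡ ∏ n (does ∘ P?) f
  product-filter-upTo f zero = refl
  product-filter-upTo f (suc n) rewrite filter-upTo-suc n | map-++ f (filter P? (upTo n)) (filter P? [ n ]) | product-++ (map f (filter P? (upTo n))) (map f (filter P? [ n ])) | product-filter-upTo f n with P? n
  ... | yes _ = cong (∏ n (does ∘ P?) f *_) (*-identityʳ (f n))
  ... | no _ = refl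

filter-filter : ∀ {a p q} {A : Set a} {P : Pred A p} {Q : Pred A q} (P? : Decidable P) (Q? : Decidable Q) xs →
                filter P? (filter Q? xs) ≡ filter (λ x → Q? x ×-dec P? x) xs
filter-filter P? Q? [] = refl
filter-filter P? Q? (x ∷ xs) with Q? x
... | no _ = filter-filter P? Q? xs
... | yes _ with P? x
...   | yes _ = cong (x ∷_) (filter-filter P? Q? xs)
...   | no _ = filter-filter P? Q? xs

product-filter²-upTo : ∀ {P Q : Pred ℕ 0ℓ} (P? : Decidable P) (Q? : Decidable Q) (f : ℕ → ℕ) n →
  product (map f (filter P? (filter Q? (upTo n)))) ≡ ∏ n (λ i → does (Q? i) ∧ does (P? i)) f
product-filter²-upTo P? Q? f n = trans (cong (product ∘ map f) (filter-filter P? Q? (upTo n))) (product-filter-upTo (λ x → Q? x ×-dec P? x) f n)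

primeᵇ : ℕ → Bool
primeᵇ i = does (prime? i)

primeᵇ⇒Prime : ∀ {i} → primeᵇ i ≡ true → Prime i
primeᵇ⇒Prime {i} = does≡true⇒ (prime? i)

Prime⇒primeᵇ : ∀ {i} → Prime i → primeᵇ i ≡ true
Prime⇒primeᵇ {i} = dec-true (prime? i)

¬Prime⇒primeᵇ : ∀ {i} → ¬ Prime i → primeᵇ i ≡ false
¬Prime⇒primeᵇ {i} = dec-false (prime? i)

prime⇒≥2 : ∀ {q} → Prime q → 2 ≤ q
prime⇒≥2 {q} pq = nonTrivial⇒n>1 q {{prime⇒nonTrivial pq}}

prime⇒≢1 : ∀ {q} → Prime q → q ≢ 1
prime⇒≢1 pq = nonTrivial⇒≢1 {{prime⇒nonTrivial pq}}

prime∣prime⇒≡ : ∀ {q p} → Prime q → Prime p → q ∣ p → q ≡ p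
prime∣prime⇒≡ pq pp q∣p with prime⇒irreducible pp q∣p
... | inj₁ e = ⊥-elim (prime⇒≢1 pq e)
... | inj₂ e = e

primorial< : ℕ → ℕ
primorial< n = ∏ n primeᵇ (λ i → i)

prime∣∏⇒< : ∀ n (b : ℕ → Bool) → (∀ i → b i ≡ true → Prime i) → ∀ {q} → Prime q → q ∣ ∏ n b (λ i → i) → q < n
prime∣∏⇒< zero b hb pq q∣1 = ⊥-elim (prime⇒≢1 pq (∣1⇒≡1 q∣1))
prime∣∏⇒< (suc n) b hb {q} pq q∣ with b n in eq
... | true with euclidsLemma (∏ n b (λ i → i)) n pq q∣
...   | inj₁ h = m<n⇒m<1+n (prime∣∏⇒< n b hb pq h)
...   | inj₂ h = s≤s (≤-reflexive (prime∣prime⇒≡ pq (hb n eq) h))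
prime∣∏⇒< (suc n) b hb {q} pq q∣ | false = m<n⇒m<1+n (prime∣∏⇒< n b hb pq (subst (q ∣_) (*-identityʳ _) q∣))

factor∣∏ : ∀ n (b : ℕ → Bool) {q} → b q ≡ true → q < n → q ∣ ∏ n b (λ i → i)
factor∣∏ (suc n) b {q} bq q<sn with q ≟ n
... | yes refl rewrite bq = n∣m*n (∏ q b (λ i → i))
... | no q≢n = ∣m⇒∣m*n _ (factor∣∏ n b bq (≤∧≢⇒< (≤-pred q<sn) q≢n))

∏-primes-positive : ∀ n (b : ℕ → Bool) → (∀ i → b i ≡ true → Prime i) → 1 ≤ ∏ n b (λ i → i)
∏-primes-positive n b hb = ∏-positive n b (λ i → i) (λ i bi → <⇒≤ (prime⇒≥2 (hb i bi)))

primorial<-positive : ∀ n → 1 ≤ primorial< n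
primorial<-positive n = ∏-primes-positive n primeᵇ (λ i → primeᵇ⇒Prime)

∃prime∣ : ∀ d → 2 ≤ d → ∃[ q ] (Prime q × q ∣ d)
∃prime∣ (suc zero) (s≤s ())
∃prime∣ (suc (suc k)) _ with factorise (suc (suc k))
... | record { factors = [] ; isFactorisation = () }
... | record { factors = q ∷ qs ; isFactorisation = e ; factorsPrime = pq ∷ _ } = q , pq , divides (product qs) (trans e (*-comm q (product qs)))

NoPrimeFactorBelow : ℕ → ℕ → Set
NoPrimeFactorBelow n x = ∀ q → Prime q → q < n → ¬ q ∣ x

coprime-primorial<⇒ : ∀ n x → Coprime x (primorial< n) → NoPrimeFactorBelow n x
coprime-primorial<⇒ n x c q pq q<n q∣x = prime⇒≢1 pq (c (q∣x , factor∣∏ n primeᵇ (Prime⇒primeᵇ pq) q<n))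

coprime-primorial<⇐ : ∀ n x → NoPrimeFactorBelow n x → Coprime x (primorial< n)
coprime-primorial<⇐ n x cp {zero} (_ , 0∣P) = ⊥-elim (<-irrefl (sym (0∣⇒≡0 0∣P)) (primorial<-positive n))
coprime-primorial<⇐ n x cp {suc zero} _ = refl
coprime-primorial<⇐ n x cp {suc (suc k)} (d∣x , d∣P) with ∃prime∣ (suc (suc k)) (s≤s (s≤s z≤n))
... | q , pq , q∣d = ⊥-elim (cp q pq (prime∣∏⇒< n primeᵇ (λ i → primeᵇ⇒Prime) pq (∣-trans q∣d d∣P)) (∣-trans q∣d d∣x))

primorial<-suc : ∀ n → Prime n → primorial< (suc n) ≡ primorial< n * n
primorial<-suc n pn rewrite Prime⇒primeᵇ pn = refl

primorial<-suc-¬prime : ∀ n → ¬ Prime n → primorial< (suc n) ≡ primorial< n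
primorial<-suc-¬prime n pn rewrite ¬Prime⇒primeᵇ pn = *-identityʳ _

∏-suc-prime : ∀ n (g : ℕ → ℕ) → Prime n → ∏ (suc n) primeᵇ g ≡ ∏ n primeᵇ g * g n
∏-suc-prime n g pn rewrite Prime⇒primeᵇ pn = refl

∏-suc-¬prime : ∀ n (g : ℕ → ℕ) → ¬ Prime n → ∏ (suc n) primeᵇ g ≡ ∏ n primeᵇ g
∏-suc-¬prime n g pn rewrite ¬Prime⇒primeᵇ pn = *-identityʳ _

NoPrimeFactorBelow-pred : ∀ n x → NoPrimeFactorBelow (suc n) x → NoPrimeFactorBelow n x
NoPrimeFactorBelow-pred n x c q pq q<n = c q pq (m<n⇒m<1+n q<n)

NoPrimeFactorBelow-suc⇒∤ : ∀ n x → Prime n → NoPrimeFactorBelow (suc n) x → ¬ n ∣ x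
NoPrimeFactorBelow-suc⇒∤ n x pn c = c n pn ≤-refl

NoPrimeFactorBelow-suc : ∀ n x → NoPrimeFactorBelow n x → ¬ n ∣ x → NoPrimeFactorBelow (suc n) x
NoPrimeFactorBelow-suc n x c n∤x q pq q<1+n with q ≟ n
... | yes refl = n∤x
... | no q≢n = c q pq (≤∧≢⇒< (≤-pred q<1+n) q≢n)

coprime-+-multiple⁻ : ∀ k m a → Coprime (k * m + a) m → Coprime a m
coprime-+-multiple⁻ k m a c (d∣a , d∣m) = c (∣m∣n⇒∣m+n (∣n⇒∣m*n k d∣m) d∣a , d∣m)

coprime-+-multiple⁺ : ∀ k m a → Coprime a m → Coprime (k * m + a) m
coprime-+-multiple⁺ k m a c (d∣ , d∣m) = c (∣m+n∣m⇒∣n d∣ (∣n⇒∣m*n k d∣m) , d∣m)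

module _ (n : ℕ) (pn : Prime n) where

  coprime-primorial<-suc⁻ : ∀ y → Coprime y (primorial< n * n) → Coprime y (primorial< n) × ¬ n ∣ y
  coprime-primorial<-suc⁻ y c = coprime-primorial<⇐ n y (NoPrimeFactorBelow-pred n y c′) , NoPrimeFactorBelow-suc⇒∤ n y pn c′
    where c′ = coprime-primorial<⇒ (suc n) y (subst (Coprime y) (sym (primorial<-suc n pn)) c)

  coprime-primorial<-suc⁺ : ∀ y → Coprime y (primorial< n) → ¬ n ∣ y → Coprime y (primorial< n * n)
  coprime-primorial<-suc⁺ y c n∤y = subst (Coprime y) (primorial<-suc n pn) (coprime-primorial<⇐ (suc n) y (NoPrimeFactorBelow-suc n y (coprime-primorial<⇒ n y c) n∤y))

-- Moduli are written suc k, so that the NonZero instances needed by _%_ and _/_ are found automatically.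

%≡%⇒∣∸ : ∀ k a b → b ≤ a → a % suc k ≡ b % suc k → suc k ∣ a ∸ b
%≡%⇒∣∸ k a b b≤a e = divides (a / n ∸ b / n) (begin
    a ∸ b
  ≡⟨ cong₂ _∸_ (m≡m%n+[m/n]*n a n) (m≡m%n+[m/n]*n b n) ⟩
    (a % n + a / n * n) ∸ (b % n + b / n * n)
  ≡⟨ cong (λ r → (r + a / n * n) ∸ (b % n + b / n * n)) e ⟩
    (b % n + a / n * n) ∸ (b % n + b / n * n)
  ≡⟨ [m+n]∸[m+o]≡n∸o (b % n) _ _ ⟩
    a / n * n ∸ b / n * n
  ≡⟨ sym (*-distribʳ-∸ n (a / n) (b / n)) ⟩
    (a / n ∸ b / n) * n ∎)
  where
  n = suc k
  open ≡-Reasoning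

∣∧<⇒≡0 : ∀ {n k} → n ∣ k → k < n → k ≡ 0
∣∧<⇒≡0 {n} {zero} _ _ = refl
∣∧<⇒≡0 {n} {suc k} d k<n = ⊥-elim (<-irrefl refl (<-≤-trans k<n (∣⇒≤ d)))

private
  affine-%-injective-≤ : ∀ k m x → Prime (suc k) → ¬ suc k ∣ m → ∀ y y' → y < suc k → y' ≤ y →
                         (y * m + x) % suc k ≡ (y' * m + x) % suc k → y ≡ y'
  affine-%-injective-≤ k m x pn n∤m y y' y<n y'≤y e = ≤-antisym (m∸n≡0⇒m≤n y∸y'≡0) y'≤y
    where
    n∣[y∸y']m : suc k ∣ (y ∸ y') * m
    n∣[y∸y']m = subst (suc k ∣_)
      (trans (cong₂ _∸_ (+-comm (y * m) x) (+-comm (y' * m) x)) (trans ([m+n]∸[m+o]≡n∸o x (y * m) (y' * m)) (sym (*-distribʳ-∸ m y y'))))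
      (%≡%⇒∣∸ k (y * m + x) (y' * m + x) (+-monoˡ-≤ x (*-monoˡ-≤ m y'≤y)) e)
    y∸y'≡0 : y ∸ y' ≡ 0
    y∸y'≡0 with euclidsLemma (y ∸ y') m pn n∣[y∸y']m
    ... | inj₁ n∣y∸y' = ∣∧<⇒≡0 n∣y∸y' (≤-<-trans (m∸n≤m y y') y<n)
    ... | inj₂ n∣m = contradiction n∣m n∤m

affine-%-injective : ∀ k m x → Prime (suc k) → ¬ suc k ∣ m → ∀ y y' → y < suc k → y' < suc k →
                     (y * m + x) % suc k ≡ (y' * m + x) % suc k → y ≡ y'
affine-%-injective k m x pn n∤m y y' y<n y'<n e with ≤-total y' y
... | inj₁ y'≤y = affine-%-injective-≤ k m x pn n∤m y y' y<n y'≤y e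
... | inj₂ y≤y' = sym (affine-%-injective-≤ k m x pn n∤m y' y y'<n y≤y' (sym e))

private
  +-%-split : ∀ k a σ → a + σ ≡ a / suc k * suc k + (a % suc k + σ)
  +-%-split k a σ = trans (cong (_+ σ) (trans (m≡m%n+[m/n]*n a (suc k)) (+-comm (a % suc k) _))) (+-assoc (a / suc k * suc k) _ σ)

∣+⇒∣%+ : ∀ k a σ → suc k ∣ a + σ → suc k ∣ a % suc k + σ
∣+⇒∣%+ k a σ d = ∣m+n∣m⇒∣n (subst (suc k ∣_) (+-%-split k a σ) d) (n∣m*n (a / suc k))

∣%+⇒∣+ : ∀ k a σ → suc k ∣ a % suc k + σ → suc k ∣ a + σ
∣%+⇒∣+ k a σ d = subst (suc k ∣_) (sym (+-%-split k a σ)) (∣m∣n⇒∣m+n (n∣m*n (a / suc k)) d)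

∣+⇒≡negMod : ∀ k r s → r < suc k → s < suc k → suc k ∣ r + s → s ≡ (suc k ∸ r) % suc k
∣+⇒≡negMod k r s r< s< (divides zero e) rewrite m+n≡0⇒m≡0 r e | m+n≡0⇒n≡0 r e = sym (n%n≡0 (suc k))
∣+⇒≡negMod k zero s r< s< (divides (suc zero) e) = ⊥-elim (<-irrefl (trans e (+-identityʳ (suc k))) s<)
∣+⇒≡negMod k (suc r) s r< s< (divides (suc zero) e) = trans (sym (trans (cong (_∸ suc r) (sym (trans e (+-identityʳ (suc k))))) (m+n∸m≡n (suc r) s))) (sym (m<n⇒m%n≡m (s≤s (m∸n≤m k r))))
∣+⇒≡negMod k r s r< s< (divides (suc (suc q)) e) = ⊥-elim (<-irrefl e (<-≤-trans (+-mono-< r< s<) (+-monoʳ-≤ (suc k) (m≤m+n (suc k) (q * suc k)))))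

≡negMod⇒∣+ : ∀ k r s → r < suc k → s ≡ (suc k ∸ r) % suc k → suc k ∣ r + s
≡negMod⇒∣+ k zero s r< e = subst (suc k ∣_) (sym (trans e (n%n≡0 (suc k)))) ((suc k) ∣0)
≡negMod⇒∣+ k (suc r) s r< e rewrite e | m<n⇒m%n≡m {suc k} {suc k ∸ suc r} (s≤s (m∸n≤m k r)) | m+[n∸m]≡n {suc r} {suc k} (<⇒≤ r<) = ∣-refl

∣+⇒%≡negMod : ∀ k r σ → r < suc k → suc k ∣ r + σ → σ % suc k ≡ (suc k ∸ r) % suc k
∣+⇒%≡negMod k r σ r< d = ∣+⇒≡negMod k r (σ % suc k) r< (m%n<n σ (suc k)) (subst (suc k ∣_) (+-comm (σ % suc k) r) (∣+⇒∣%+ k σ r (subst (suc k ∣_) (+-comm r σ) d)))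

%≡negMod⇒∣+ : ∀ k r σ → r < suc k → σ % suc k ≡ (suc k ∸ r) % suc k → suc k ∣ r + σ
%≡negMod⇒∣+ k r σ r< e = subst (suc k ∣_) (+-comm σ r) (∣%+⇒∣+ k σ r (subst (suc k ∣_) (+-comm r (σ % suc k)) (≡negMod⇒∣+ k r (σ % suc k) r< e)))

negMod-injective : ∀ k r r' → r < suc k → r' < suc k → (suc k ∸ r) % suc k ≡ (suc k ∸ r') % suc k → r ≡ r'
negMod-injective k zero zero _ _ _ = refl
negMod-injective k zero (suc r') _ r'< e rewrite n%n≡0 (suc k) ⦃ _ ⦄ | m<n⇒m%n≡m {suc k} {suc k ∸ suc r'} (s≤s (m∸n≤m k r')) = ⊥-elim (<-irrefl e (m<n⇒0<n∸m r'<))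
negMod-injective k (suc r) zero r< _ e rewrite n%n≡0 (suc k) ⦃ _ ⦄ | m<n⇒m%n≡m {suc k} {suc k ∸ suc r} (s≤s (m∸n≤m k r)) = ⊥-elim (<-irrefl (sym e) (m<n⇒0<n∸m r<))
negMod-injective k (suc r) (suc r') r< r'< e rewrite m<n⇒m%n≡m {suc k} {suc k ∸ suc r} (s≤s (m∸n≤m k r)) | m<n⇒m%n≡m {suc k} {suc k ∸ suc r'} (s≤s (m∸n≤m k r')) =
  cong suc (+-cancelˡ-≡ (k ∸ r) r r' (trans (m∸n+n≡m (<⇒≤ (≤-pred r<))) (trans (sym (m∸n+n≡m (<⇒≤ (≤-pred r'<)))) (cong (_+ r') (sym e)))))

-- Counting shifts coprime to a primorial

ν : ℕ → List ℕ → ℕ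
ν zero L = 0
ν (suc k) L = length (filter (λ r → any? (λ σ → (σ % suc k) ≟ r) L) (upTo (suc k)))

coprimeAt : ℕ → List ℕ → ℕ → ℕ
coprimeAt V L γ = χ (all? (λ σ → coprime? (γ + σ) V) L)

avoidsAt : ℕ → List ℕ → ℕ → ℕ
avoidsAt n L γ = χ (all? (λ σ → ¬? (n ∣? (γ + σ))) L)

occurrences : ℕ → List ℕ → ℕ
occurrences V L = ∑ V (coprimeAt V L)

coprimeAt-primorial<-suc : ∀ n L γ → Prime n → coprimeAt (primorial< n * n) L γ ≡ coprimeAt (primorial< n) L γ * avoidsAt n L γ
coprimeAt-primorial<-suc n L γ pn = trans
  (χ-cong (All.unzipWith (λ {σ} → coprime-primorial<-suc⁻ n pn (γ + σ)))
          (All.zipWith {P = λ σ → Coprime (γ + σ) (primorial< n)} {Q = λ σ → ¬ n ∣ γ + σ}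
                       (λ {σ} (c₁ , c₂) {d} → coprime-primorial<-suc⁺ n pn (γ + σ) c₁ c₂ {d}))
          _ (A? ×-dec B?))
  (χ-× A? B?)
  where
  A? = all? (λ σ → coprime? (γ + σ) (primorial< n)) L
  B? = all? (λ σ → ¬? (n ∣? (γ + σ))) L

coprimeAt-periodic : ∀ V L y x → coprimeAt V L (y * V + x) ≡ coprimeAt V L x
coprimeAt-periodic V L y x = χ-cong (All.map (λ {σ} → shift⁻ σ)) (All.map (λ {σ} → shift⁺ σ)) _ _
  where
  shift⁻ : ∀ σ → Coprime (y * V + x + σ) V → Coprime (x + σ) V
  shift⁻ σ c = coprime-+-multiple⁻ y V (x + σ) (subst (λ z → Coprime z V) (+-assoc (y * V) x σ) c)
  shift⁺ : ∀ σ → Coprime (x + σ) V → Coprime (y * V + x + σ) V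
  shift⁺ σ c = subst (λ z → Coprime z V) (sym (+-assoc (y * V) x σ)) (coprime-+-multiple⁺ y V (x + σ) c)

avoidsAt-% : ∀ k L a → avoidsAt (suc k) L a ≡ avoidsAt (suc k) L (a % suc k)
avoidsAt-% k L a = χ-cong (All.map (λ {σ} n∤ d → n∤ (∣%+⇒∣+ k a σ d))) (All.map (λ {σ} n∤ d → n∤ (∣+⇒∣%+ k a σ d))) _ _

-- r is hit by some σ ∈ L iff σ ≡ −r (mod n), and r ↦ −r permutes the residues.
∑-avoidsAt : ∀ k L → Prime (suc k) → ∑ (suc k) (avoidsAt (suc k) L) ≡ suc k ∸ ν (suc k) L
∑-avoidsAt k L pn = begin
    ∑ n (avoidsAt n L)
  ≡⟨ ∑-cong n (λ r _ → trans (χ-cong All¬⇒¬Any (¬Any⇒All¬ L) _ (¬? (any? (λ σ → n ∣? (r + σ)) L))) (χ-¬ _)) ⟩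
    ∑[ r < n ] 1 ∸ χ (any? (λ σ → n ∣? (r + σ)) L)
  ≡⟨ ∑-1∸ n _ (λ i _ → χ≤1 _) ⟩
    n ∸ (∑[ r < n ] χ (any? (λ σ → n ∣? (r + σ)) L))
  ≡⟨ cong (n ∸_) (∑-cong n (λ r r<n → χ-cong (Any.map (∣+⇒%≡negMod k r _ r<n)) (Any.map (%≡negMod⇒∣+ k r _ r<n)) _ _)) ⟩
    n ∸ (∑[ r < n ] χ (any? (λ σ → σ % n ≟ negMod r) L))
  ≡⟨ cong (n ∸_) (∑-reindex n negMod (λ r _ → m%n<n (n ∸ r) n) (negMod-injective k) (λ u → χ (any? (λ σ → σ % n ≟ u) L))) ⟩
    n ∸ (∑[ r < n ] χ (any? (λ σ → σ % n ≟ r) L))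
  ≡⟨ cong (n ∸_) (sym (length-filter-upTo (λ r → any? (λ σ → σ % n ≟ r) L) n)) ⟩
    n ∸ ν n L
  ∎
  where
  open ≡-Reasoning
  n = suc k
  negMod : ℕ → ℕ
  negMod r = (n ∸ r) % n

-- The Chinese remainder step: γ < V·n is split as y·V + x, and for fixed x the map y ↦ (y·V + x) mod n is a bijection.
occurrences-primorial<-suc : ∀ k L → Prime (suc k) → occurrences (primorial< (suc k) * suc k) L ≡ occurrences (primorial< (suc k)) L * (suc k ∸ ν (suc k) L)
occurrences-primorial<-suc k L pn = begin
    occurrences (V * n) L
  ≡⟨ ∑-cong (V * n) (λ γ _ → coprimeAt-primorial<-suc n L γ pn) ⟩
    ∑[ γ < V * n ] coprimeAt V L γ * avoidsAt n L γ
  ≡⟨ cong (λ z → ∑[ γ < z ] coprimeAt V L γ * avoidsAt n L γ) (*-comm V n) ⟩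
    ∑[ γ < n * V ] coprimeAt V L γ * avoidsAt n L γ
  ≡⟨ ∑-*-range n V _ ⟩
    ∑[ y < n ] ∑[ x < V ] coprimeAt V L (y * V + x) * avoidsAt n L (y * V + x)
  ≡⟨ ∑-cong n (λ y _ → ∑-cong V (λ x _ → cong₂ _*_ (coprimeAt-periodic V L y x) (avoidsAt-% k L (y * V + x)))) ⟩
    ∑[ y < n ] ∑[ x < V ] coprimeAt V L x * avoidsAt n L ((y * V + x) % n)
  ≡⟨ ∑-comm n V _ ⟩
    ∑[ x < V ] ∑[ y < n ] coprimeAt V L x * avoidsAt n L ((y * V + x) % n)
  ≡⟨ ∑-cong V (λ x _ → ∑-*ˡ n (coprimeAt V L x) (λ y → avoidsAt n L ((y * V + x) % n))) ⟩
    ∑[ x < V ] coprimeAt V L x * (∑[ y < n ] avoidsAt n L ((y * V + x) % n))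
  ≡⟨ ∑-cong V (λ x _ → cong (coprimeAt V L x *_) (∑-reindex n (λ y → (y * V + x) % n) (λ y _ → m%n<n (y * V + x) n) (affine-%-injective k V x pn n∤V) (avoidsAt n L))) ⟩
    ∑[ x < V ] coprimeAt V L x * ∑ n (avoidsAt n L)
  ≡⟨ ∑-*ʳ V (∑ n (avoidsAt n L)) (coprimeAt V L) ⟩
    occurrences V L * ∑ n (avoidsAt n L)
  ≡⟨ cong (occurrences V L *_) (∑-avoidsAt k L pn) ⟩
    occurrences V L * (n ∸ ν n L)
  ∎
  where
  open ≡-Reasoning
  n = suc k
  V = primorial< n
  n∤V : ¬ n ∣ V
  n∤V d = <-irrefl refl (prime∣∏⇒< n primeᵇ (λ i → primeᵇ⇒Prime) pn d)

occurrences-primorial< : ∀ n L → occurrences (primorial< n) L ≡ ∏ n primeᵇ (λ q → q ∸ ν q L)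
occurrences-primorial<-step : ∀ n L → Dec (Prime n) → occurrences (primorial< (suc n)) L ≡ ∏ (suc n) primeᵇ (λ q → q ∸ ν q L)

occurrences-primorial< zero L = χ-yes _ (All.universal (λ σ {d} → Coprimality.sym (1-coprimeTo (0 + σ)) {d}) L)
occurrences-primorial< (suc n) L = occurrences-primorial<-step n L (prime? n)

occurrences-primorial<-step n L (no ¬pn) = begin
    occurrences (primorial< (suc n)) L  ≡⟨ cong (λ V → occurrences V L) (primorial<-suc-¬prime n ¬pn) ⟩
    occurrences (primorial< n) L        ≡⟨ occurrences-primorial< n L ⟩
    ∏ n primeᵇ g                        ≡⟨ sym (∏-suc-¬prime n g ¬pn) ⟩
    ∏ (suc n) primeᵇ g                  ∎
  where
  open ≡-Reasoning
  g = λ q → q ∸ ν q L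
occurrences-primorial<-step zero L (yes pn) = contradiction (prime⇒≥2 pn) λ ()
occurrences-primorial<-step n@(suc k) L (yes pn) = begin
    occurrences (primorial< (suc n)) L        ≡⟨ cong (λ V → occurrences V L) (primorial<-suc n pn) ⟩
    occurrences (primorial< n * n) L          ≡⟨ occurrences-primorial<-suc k L pn ⟩
    occurrences (primorial< n) L * g n        ≡⟨ cong (_* g n) (occurrences-primorial< n L) ⟩
    ∏ n primeᵇ g * g n                        ≡⟨ sym (∏-suc-prime n g pn) ⟩
    ∏ (suc n) primeᵇ g                        ∎
  where
  open ≡-Reasoning
  g = λ q → q ∸ ν q L

primorial≡primorial< : ∀ p → primorial p ≡ primorial< (suc p)
primorial≡primorial< p = trans (cong product (sym (map-id (primesUpTo p)))) (product-filter-upTo prime? (λ i → i) (suc p))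

occurrences-primorial : ∀ p L → occurrences (primorial p) L ≡ ∏ (suc p) primeᵇ (λ q → q ∸ ν q L)
occurrences-primorial p L = trans (cong (λ V → occurrences V L) (primorial≡primorial< p)) (occurrences-primorial< (suc p) L)

nu≡ν : ∀ q s → nu q s ≡ ν q (sigmas s)
nu≡ν zero s = refl
nu≡ν (suc q) s = refl

product-nu≡∏ : ∀ p s → product (map (λ q → q ∸ nu q s) (primesUpTo p)) ≡ ∏ (suc p) primeᵇ (λ q → q ∸ ν q (sigmas s))
product-nu≡∏ p s = trans (product-filter-upTo prime? (λ q → q ∸ nu q s) (suc p)) (∏-cong (suc p) (λ _ _ → refl) (λ q _ _ → cong (q ∸_) (nu≡ν q s)))

extra≤sigmaJ : ∀ p s γ → extra p s γ ≤ sigmaJ s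
extra≤sigmaJ p s γ = ≤-trans (length-filter _ (upTo (sigmaJ s))) (≤-reflexive (length-upTo (sigmaJ s)))

nsj≡∑ : ∀ s j p → nsj s j p ≡ ∑[ γ < primorial p ] coprimeAt (primorial p) (sigmas s) γ * χ (length s + extra p s γ ≟ j)
nsj≡∑ s j p = trans (length-filter-upTo _ (primorial p)) (∑-cong (primorial p) (λ γ _ → χ-× (all? (λ σ → coprime? (γ + σ) (primorial p)) (sigmas s)) (length s + extra p s γ ≟ j)))

-- Each occurrence of s is a driving term of exactly one length, namely J + extra.
sumDriving≡∏ : ∀ s p → sumDriving s p ≡ product (map (λ q → q ∸ nu q s) (primesUpTo p))
sumDriving≡∏ s p = begin
    sumDriving s p
  ≡⟨ sum-map-upTo (λ i → nsj s (J + i) p) (suc σ) ⟩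
    ∑[ i < suc σ ] nsj s (J + i) p
  ≡⟨ ∑-cong (suc σ) (λ i _ → nsj≡∑ s (J + i) p) ⟩
    ∑[ i < suc σ ] ∑[ γ < P ] coprimeAt P L γ * χ (J + extra p s γ ≟ J + i)
  ≡⟨ ∑-comm (suc σ) P _ ⟩
    ∑[ γ < P ] ∑[ i < suc σ ] coprimeAt P L γ * χ (J + extra p s γ ≟ J + i)
  ≡⟨ ∑-cong P (λ γ _ → trans (∑-*ˡ (suc σ) (coprimeAt P L γ) _) (trans (cong (coprimeAt P L γ *_) (one-length γ)) (*-identityʳ _))) ⟩
    occurrences P L
  ≡⟨ occurrences-primorial p L ⟩
    ∏ (suc p) primeᵇ (λ q → q ∸ ν q L)
  ≡⟨ sym (product-nu≡∏ p s) ⟩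
    product (map (λ q → q ∸ nu q s) (primesUpTo p))
  ∎
  where
  open ≡-Reasoning
  J = length s
  σ = sigmaJ s
  P = primorial p
  L = sigmas s
  one-length : ∀ γ → ∑[ i < suc σ ] χ (J + extra p s γ ≟ J + i) ≡ 1
  one-length γ = trans (∑-cong (suc σ) (λ i _ → trans (χ-cong (+-cancelˡ-≡ J _ _) (cong (J +_)) _ (extra p s γ ≟ i)) (sym (*-identityʳ _))))
                       (∑-χ≟ (suc σ) (extra p s γ) (λ _ → 1) (s≤s (extra≤sigmaJ p s γ)))

-- Euler's product bound

Smooth : ℕ → ℕ → Set
Smooth t n = ∀ q → Prime q → q ∣ n → q < t

smooth? : ∀ t i → Dec (Smooth t (suc i))
smooth? t i with anyUpTo? (λ q → prime? q ×-dec (q ∣? suc i) ×-dec (t ≤? q)) (suc (suc i))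
... | yes (q , _ , pq , q∣ , t≤q) = no (λ sm → <-irrefl refl (<-≤-trans (sm q pq q∣) t≤q))
... | no ∄q = yes smooth
  where
  smooth : Smooth t (suc i)
  smooth q pq q∣ with t ≤? q
  ... | yes t≤q = ⊥-elim (∄q (q , s≤s (∣⇒≤ q∣) , pq , q∣ , t≤q))
  ... | no t≰q = ≰⇒> t≰q

smoothHarmonic : ℕ → ℕ → ℕ → ℕ
smoothHarmonic t X K = ∑[ i < X ] χ (smooth? t i) * (K / suc i)

∏primes : ℕ → ℕ
∏primes t = ∏ t primeᵇ (λ q → q)

∏primes[q-1] : ℕ → ℕ
∏primes[q-1] t = ∏ t primeᵇ (λ q → q ∸ 1)

-- Euler's identity ∑_{n t-smooth} 1/n = ∏_{q < t} q/(q-1), as an inequality between integers.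
EulerBound : ℕ → Set
EulerBound t = ∀ X K → smoothHarmonic t X K * ∏primes[q-1] t ≤ K * ∏primes t

[r+q*n]/n≡q : ∀ k r q → r < suc k → (r + q * suc k) / suc k ≡ q
[r+q*n]/n≡q k r q r<n = trans (+-distrib-/-∣ʳ r (n∣m*n q)) (cong₂ _+_ (m<n⇒m/n≡0 r<n) (m*n/n≡m q (suc k)))

suc-/ : ∀ k X → (suc X / suc k ≡ X / suc k × ¬ suc k ∣ suc X) ⊎ (suc X / suc k ≡ suc (X / suc k) × suc X ≡ suc k * suc (X / suc k))
suc-/ k X with m≤n⇒m<n∨m≡n (m%n<n X (suc k))
... | inj₁ 1+r<n = inj₁ (trans (cong (_/ suc k) 1+X≡) ([r+q*n]/n≡q k (suc r) q 1+r<n) , n∤1+X)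
  where
  r = X % suc k
  q = X / suc k
  1+X≡ : suc X ≡ suc r + q * suc k
  1+X≡ = cong suc (m≡m%n+[m/n]*n X (suc k))
  n∤1+X : ¬ suc k ∣ suc X
  n∤1+X d = <-irrefl refl (<-≤-trans 1+r<n (∣⇒≤ (∣m+n∣m⇒∣n (subst (suc k ∣_) (trans 1+X≡ (+-comm (suc r) (q * suc k))) d) (n∣m*n q))))
... | inj₂ 1+r≡n = inj₂ (trans (cong (_/ suc k) 1+X≡) ([r+q*n]/n≡q k 0 (suc q) (s≤s z≤n)) , trans 1+X≡ (*-comm (suc q) (suc k)))
  where
  q = X / suc k
  1+X≡ : suc X ≡ 0 + suc q * suc k
  1+X≡ = trans (cong suc (m≡m%n+[m/n]*n X (suc k))) (cong (_+ q * suc k) 1+r≡n)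

∑-multiples : ∀ k (g : ℕ → ℕ) X → ∑[ i < X ] χ (suc k ∣? suc i) * g (suc i) ≡ ∑[ j < X / suc k ] g (suc k * suc j)
∑-multiples k g zero = refl
∑-multiples k g (suc X) with suc-/ k X
... | inj₁ (e , n∤) = trans (cong₂ _+_ (∑-multiples k g X) (cong (_* g (suc X)) (χ-no (suc k ∣? suc X) n∤)))
                            (trans (+-identityʳ _) (cong (λ z → ∑[ j < z ] g (suc k * suc j)) (sym e)))
... | inj₂ (e , 1+X≡) = trans (cong₂ _+_ (∑-multiples k g X) (trans (cong (_* g (suc X)) (χ-yes (suc k ∣? suc X) n∣))
                                (trans (+-identityʳ _) (cong g 1+X≡))))
                              (cong (λ z → ∑[ j < z ] g (suc k * suc j)) (sym e))
  where n∣ = divides (suc (X / suc k)) (trans 1+X≡ (*-comm (suc k) _))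

Smooth-pred-∤ : ∀ t n → Smooth (suc t) n → ¬ t ∣ n → Smooth t n
Smooth-pred-∤ t n sm t∤n q pq q∣n with q ≟ t
... | yes refl = contradiction q∣n t∤n
... | no q≢t = ≤∧≢⇒< (≤-pred (sm q pq q∣n)) q≢t

Smooth-pred-¬prime : ∀ t n → ¬ Prime t → Smooth (suc t) n → Smooth t n
Smooth-pred-¬prime t n ¬pt sm q pq q∣n with q ≟ t
... | yes refl = contradiction pq ¬pt
... | no q≢t = ≤∧≢⇒< (≤-pred (sm q pq q∣n)) q≢t

Smooth-*⁻ : ∀ t m → Smooth (suc t) (t * m) → Smooth (suc t) m
Smooth-*⁻ t m sm q pq q∣m = sm q pq (∣n⇒∣m*n t q∣m)

Smooth-*⁺ : ∀ t m → Prime t → Smooth (suc t) m → Smooth (suc t) (t * m)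
Smooth-*⁺ t m pt sm q pq q∣tm with euclidsLemma t m pq q∣tm
... | inj₁ q∣t = s≤s (≤-reflexive (prime∣prime⇒≡ pq pt q∣t))
... | inj₂ q∣m = sm q pq q∣m

*≤⇒≤/ : ∀ x d y → x * suc d ≤ y → x ≤ y / suc d
*≤⇒≤/ x d y le = subst (_≤ y / suc d) (m*n/n≡m x (suc d)) (/-monoˡ-≤ (suc d) le)

eulerBound-zero : EulerBound 0
eulerBound-zero X K = begin
    smoothHarmonic 0 X K * 1    ≡⟨ *-identityʳ _ ⟩
    smoothHarmonic 0 X K        ≤⟨ ∑-mono-≤ X (λ i _ → term≤ i) ⟩
    ∑[ i < X ] χ (0 ≟ i) * K    ≤⟨ at-most-K X ⟩
    K                           ≡⟨ sym (*-identityʳ K) ⟩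
    K * 1                       ∎
  where
  open ≤-Reasoning
  term≤ : ∀ i → χ (smooth? 0 i) * (K / suc i) ≤ χ (0 ≟ i) * K
  term≤ zero = *-mono-≤ (χ≤1 (smooth? 0 zero)) (≤-reflexive (n/1≡n K))
  term≤ (suc i) with smooth? 0 (suc i)
  ... | no _ = z≤n
  ... | yes sm with ∃prime∣ (suc (suc i)) (s≤s (s≤s z≤n))
  ...   | q , pq , q∣ = contradiction (sm q pq q∣) λ ()
  at-most-K : ∀ X → ∑[ i < X ] χ (0 ≟ i) * K ≤ K
  at-most-K zero = z≤n
  at-most-K (suc X) = ≤-reflexive (∑-χ≟ (suc X) 0 (λ _ → K) (s≤s z≤n))

module EulerBoundPrimeStep (t' : ℕ) (pt : Prime (suc t')) (IH : EulerBound (suc t')) where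
  t = suc t'

  termAt : ℕ → ℕ → ℕ
  termAt K zero = 0
  termAt K (suc i) = χ (smooth? (suc t) i) * (K / suc i)

  term-split : ∀ K i → termAt K (suc i) ≤ χ (smooth? t i) * (K / suc i) + χ (t ∣? suc i) * termAt K (suc i)
  term-split K i with smooth? (suc t) i | smooth? t i | t ∣? suc i
  ... | no _ | _ | _ = z≤n
  ... | yes _ | w | yes _ = ≤-trans (≤-reflexive (sym (+-identityʳ (K / suc i + 0)))) (m≤n+m (K / suc i + 0 + 0) (χ w * (K / suc i)))
  ... | yes _ | yes _ | no _ = m≤m+n _ _
  ... | yes sm | no ¬sm | no t∤ = contradiction (Smooth-pred-∤ t (suc i) sm t∤) ¬sm

  multiple-term : ∀ K j → termAt K (t * suc j) ≡ χ (smooth? (suc t) j) * (K / t / suc j)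
  multiple-term K j = cong₂ _*_ (χ-cong (Smooth-*⁻ t (suc j)) (Smooth-*⁺ t (suc j) pt) (smooth? (suc t) (j + t' * suc j)) (smooth? (suc t) j))
                                (sym (m/n/o≡m/[n*o] K t (suc j)))

  -- A (t+1)-smooth n is either t-smooth or t · m with m (t+1)-smooth.
  smoothHarmonic-split : ∀ X K → smoothHarmonic (suc t) X K ≤ smoothHarmonic t X K + smoothHarmonic (suc t) (X / t) (K / t)
  smoothHarmonic-split X K = begin
      smoothHarmonic (suc t) X K
    ≤⟨ ∑-mono-≤ X (λ i _ → term-split K i) ⟩
      ∑[ i < X ] χ (smooth? t i) * (K / suc i) + χ (t ∣? suc i) * termAt K (suc i)
    ≡⟨ ∑-distrib-+ X _ _ ⟩
      smoothHarmonic t X K + (∑[ i < X ] χ (t ∣? suc i) * termAt K (suc i))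
    ≡⟨ cong (smoothHarmonic t X K +_) (trans (∑-multiples t' (termAt K) X) (∑-cong (X / t) (λ j _ → multiple-term K j))) ⟩
      smoothHarmonic t X K + smoothHarmonic (suc t) (X / t) (K / t)
    ∎
    where open ≤-Reasoning

  -- Strong induction on X, with fuel f ≥ X.
  eulerBound-fuel : ∀ f X K → X ≤ f → smoothHarmonic (suc t) X K * (∏primes[q-1] t * t') ≤ K * (∏primes t * t)
  eulerBound-fuel f zero K _ = z≤n
  eulerBound-fuel (suc f) (suc X) K (s≤s X≤f) = begin
      smoothHarmonic (suc t) (suc X) K * (A * t')
    ≤⟨ *-monoˡ-≤ (A * t') (smoothHarmonic-split (suc X) K) ⟩
      (Hₜ + H′) * (A * t')
    ≡⟨ solve 4 (λ h h′ a u → (h :+ h′) :* (a :* u) := (h :* a) :* u :+ h′ :* (a :* u)) refl Hₜ H′ A t' ⟩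
      Hₜ * A * t' + H′ * (A * t')
    ≤⟨ +-mono-≤ (*-monoˡ-≤ t' (IH (suc X) K)) (eulerBound-fuel f (suc X / t) (K / t) (≤-pred (≤-trans (m/n<m (suc X) t (prime⇒≥2 pt)) (s≤s X≤f)))) ⟩
      K * B * t' + K / t * (B * t)
    ≡⟨ cong (K * B * t' +_) (solve 3 (λ a b u → a :* (b :* u) := (a :* u) :* b) refl (K / t) B t) ⟩
      K * B * t' + K / t * t * B
    ≤⟨ +-monoʳ-≤ (K * B * t') (*-monoˡ-≤ B (m/n*n≤m K t)) ⟩
      K * B * t' + K * B
    ≡⟨ solve 3 (λ k b u → k :* b :* u :+ k :* b := k :* (b :* (con 1 :+ u))) refl K B t' ⟩
      K * (B * t)
    ∎
    where
    open ≤-Reasoning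
    Hₜ = smoothHarmonic t (suc X) K
    H′ = smoothHarmonic (suc t) (suc X / t) (K / t)
    A = ∏primes[q-1] t
    B = ∏primes t

  eulerBound-suc : EulerBound (suc t)
  eulerBound-suc X K = subst₂ (λ a b → smoothHarmonic (suc t) X K * a ≤ K * b)
    (sym (∏-suc-prime t (λ q → q ∸ 1) pt)) (sym (∏-suc-prime t (λ q → q) pt)) (eulerBound-fuel X X K ≤-refl)

eulerBound-¬prime : ∀ t → ¬ Prime t → EulerBound t → EulerBound (suc t)
eulerBound-¬prime t ¬pt IH X K = subst₂ (λ a b → smoothHarmonic (suc t) X K * a ≤ K * b)
  (sym (∏-suc-¬prime t (λ q → q ∸ 1) ¬pt)) (sym (∏-suc-¬prime t (λ q → q) ¬pt))
  (≤-trans (*-monoˡ-≤ (∏primes[q-1] t) (∑-mono-≤ X (λ i _ → *-monoˡ-≤ (K / suc i) (χ-smooth-suc≤ i)))) (IH X K))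
  where
  χ-smooth-suc≤ : ∀ i → χ (smooth? (suc t) i) ≤ χ (smooth? t i)
  χ-smooth-suc≤ i with smooth? (suc t) i | smooth? t i
  ... | no _ | _ = z≤n
  ... | yes _ | yes _ = ≤-refl
  ... | yes sm | no ¬sm = contradiction (Smooth-pred-¬prime t (suc i) ¬pt sm) ¬sm

eulerBound : ∀ t → EulerBound t
eulerBound-step : ∀ t → Dec (Prime t) → EulerBound t → EulerBound (suc t)

eulerBound zero = eulerBound-zero
eulerBound (suc t) = eulerBound-step t (prime? t) (eulerBound t)

eulerBound-step t (no ¬pt) IH = eulerBound-¬prime t ¬pt IH
eulerBound-step zero (yes pt) IH = contradiction (prime⇒≥2 pt) λ ()
eulerBound-step (suc t') (yes pt) IH = EulerBoundPrimeStep.eulerBound-suc t' pt IH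

harmonic : ℕ → ℕ
harmonic m = ∑[ i < 2 ^ m ] 2 ^ m / suc i

2*[a/d]≤2a/d : ∀ a d → 2 * (a / suc d) ≤ (2 * a) / suc d
2*[a/d]≤2a/d a d = *≤⇒≤/ (2 * (a / suc d)) d (2 * a) (≤-trans (≤-reflexive (*-assoc 2 (a / suc d) (suc d))) (*-monoʳ-≤ 2 (m/n*n≤m a (suc d))))

harmonic-suc : ∀ m → 2 * harmonic m + 2 ^ m ≤ harmonic (suc m)
harmonic-suc m = begin
    2 * harmonic m + a
  ≡⟨ cong₂ _+_ (sym (∑-*ˡ a 2 (λ i → a / suc i))) (trans (sym (*-identityʳ a)) (sym (∑-const a 1))) ⟩
    (∑[ i < a ] 2 * (a / suc i)) + (∑[ _ < a ] 1)
  ≤⟨ +-mono-≤ (∑-mono-≤ a (λ i _ → 2*[a/d]≤2a/d a i)) (∑-mono-≤ a (λ j j<a → m≥n⇒m/n>0 {2 * a} {suc (a + j)} (a+j<2a j j<a))) ⟩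
    (∑[ i < a ] (2 * a) / suc i) + (∑[ j < a ] (2 * a) / suc (a + j))
  ≡⟨ sym (∑-+-range a a (λ i → (2 * a) / suc i)) ⟩
    ∑[ i < a + a ] (2 * a) / suc i
  ≡⟨ cong (λ z → ∑[ i < z ] (2 * a) / suc i) (cong (a +_) (sym (+-identityʳ a))) ⟩
    harmonic (suc m)
  ∎
  where
  open ≤-Reasoning
  a = 2 ^ m
  a+j<2a : ∀ j → j < a → suc (a + j) ≤ 2 * a
  a+j<2a j j<a = ≤-trans (≤-reflexive (sym (+-suc a j))) (≤-trans (+-monoʳ-≤ a j<a) (≤-reflexive (cong (a +_) (sym (+-identityʳ a)))))

harmonic-lower-bound : ∀ m → 2 ^ m * (m + 2) ≤ 2 * harmonic m
harmonic-lower-bound zero = ≤-refl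
harmonic-lower-bound (suc m) = begin
    2 ^ suc m * (suc m + 2)
  ≡⟨ solve 2 (λ a m → (con 2 :* a) :* (con 1 :+ m :+ con 2) := con 2 :* (a :* (m :+ con 2)) :+ con 2 :* a) refl (2 ^ m) m ⟩
    2 * (2 ^ m * (m + 2)) + 2 * 2 ^ m
  ≤⟨ +-monoˡ-≤ (2 * 2 ^ m) (*-monoʳ-≤ 2 (harmonic-lower-bound m)) ⟩
    2 * (2 * harmonic m) + 2 * 2 ^ m
  ≡⟨ sym (*-distribˡ-+ 2 (2 * harmonic m) (2 ^ m)) ⟩
    2 * (2 * harmonic m + 2 ^ m)
  ≤⟨ *-monoʳ-≤ 2 (harmonic-suc m) ⟩
    2 * harmonic (suc m)
  ∎
  where open ≤-Reasoning

smoothHarmonic-small : ∀ t X K → X < t → smoothHarmonic t X K ≡ ∑[ i < X ] K / suc i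
smoothHarmonic-small t X K X<t = ∑-cong X (λ i i<X → trans (cong (_* (K / suc i)) (χ-yes (smooth? t i) (λ q pq q∣ → ≤-<-trans (∣⇒≤ q∣) (≤-<-trans i<X X<t)))) (+-identityʳ _))

-- Every n ≤ 2^m ≤ p is (p+1)-smooth, so the Euler bound applies to the full harmonic sum.
∏primes[q-1]-bound : ∀ m p → 2 ^ m ≤ p → (m + 2) * ∏primes[q-1] (suc p) ≤ 2 * ∏primes (suc p)
∏primes[q-1]-bound m p 2^m≤p = *-cancelˡ-≤ (2 ^ m) {{m^n≢0 2 m}} (begin
    2 ^ m * ((m + 2) * A)
  ≡⟨ sym (*-assoc (2 ^ m) (m + 2) A) ⟩
    2 ^ m * (m + 2) * A
  ≤⟨ *-monoˡ-≤ A (harmonic-lower-bound m) ⟩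
    2 * harmonic m * A
  ≡⟨ *-assoc 2 (harmonic m) A ⟩
    2 * (harmonic m * A)
  ≡⟨ cong (λ z → 2 * (z * A)) (sym (smoothHarmonic-small (suc p) (2 ^ m) (2 ^ m) (s≤s 2^m≤p))) ⟩
    2 * (smoothHarmonic (suc p) (2 ^ m) (2 ^ m) * A)
  ≤⟨ *-monoʳ-≤ 2 (eulerBound (suc p) (2 ^ m) (2 ^ m)) ⟩
    2 * (2 ^ m * B)
  ≡⟨ solve 3 (λ a b c → a :* (b :* c) := b :* (a :* c)) refl 2 (2 ^ m) B ⟩
    2 ^ m * (2 * B)
  ∎)
  where
  open ≤-Reasoning
  A = ∏primes[q-1] (suc p)
  B = ∏primes (suc p)

scanl-bounds : ∀ a s → All (λ x → a ≤ x × x ≤ a + sum s) (scanl _+_ a s)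
scanl-bounds a [] = (≤-refl , ≤-reflexive (sym (+-identityʳ a))) ∷ []
scanl-bounds a (g ∷ gs) = (≤-refl , m≤m+n a _) ∷ All.map (λ (a+g≤x , x≤) → ≤-trans (m≤m+n a g) a+g≤x , ≤-trans x≤ (≤-reflexive (+-assoc a g (sum gs)))) (scanl-bounds (a + g) gs)

scanl-increasing : ∀ a s → All (0 <_) s → AllPairs _<_ (scanl _+_ a s)
scanl-increasing a [] _ = [] ∷ []
scanl-increasing a (g ∷ gs) (g>0 ∷ gs>0) = All.map (λ (a+g≤x , _) → <-≤-trans (m<m+n a g>0) a+g≤x) (scanl-bounds (a + g) gs) ∷ scanl-increasing (a + g) gs gs>0

length-scanl : ∀ a s → length (scanl _+_ a s) ≡ suc (length s)
length-scanl a [] = refl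
length-scanl a (g ∷ gs) = cong suc (length-scanl (a + g) gs)

sigmas≤sigmaJ : ∀ s → All (_≤ sigmaJ s) (sigmas s)
sigmas≤sigmaJ s = All.map proj₂ (scanl-bounds 0 s)

DistinctMod : ℕ → List ℕ → Set
DistinctMod k = AllPairs (λ x y → x % suc k ≢ y % suc k)

ν-distinct : ∀ k L → DistinctMod k L → ν (suc k) L ≡ length L
ν-distinct k L dm = trans (length-filter-upTo (λ r → any? (λ σ → σ % n ≟ r) L) n) (∑-hit L dm)
  where
  n = suc k
  hit : List ℕ → ℕ → ℕ
  hit L r = χ (any? (λ σ → σ % n ≟ r) L)
  ∑-hit : ∀ L → DistinctMod k L → ∑ n (hit L) ≡ length L
  ∑-hit [] [] = ∑-zero n
  ∑-hit (x ∷ xs) (x≢xs ∷ dxs) = begin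
      ∑ n (hit (x ∷ xs))                             ≡⟨ ∑-cong n (λ r _ → hit-∷ r) ⟩
      ∑[ r < n ] χ (x % n ≟ r) * 1 + hit xs r        ≡⟨ ∑-distrib-+ n _ _ ⟩
      (∑[ r < n ] χ (x % n ≟ r) * 1) + ∑ n (hit xs)  ≡⟨ cong₂ _+_ (∑-χ≟ n (x % n) (λ _ → 1) (m%n<n x n)) (∑-hit xs dxs) ⟩
      suc (length xs)                                ∎
    where
    open ≡-Reasoning
    hit-∷ : ∀ r → hit (x ∷ xs) r ≡ χ (x % n ≟ r) * 1 + hit xs r
    hit-∷ r with x % n ≟ r | any? (λ σ → σ % n ≟ r) xs
    ... | yes x≡r | yes xs∋r = contradiction xs∋r (All¬⇒¬Any (All.map (λ x≢y y≡r → x≢y (trans x≡r (sym y≡r))) x≢xs))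
    ... | yes _ | no _ = refl
    ... | no _ | yes _ = refl
    ... | no _ | no _ = refl

ν-∷-mono : ∀ k x L → ν (suc k) L ≤ ν (suc k) (x ∷ L)
ν-∷-mono k x L = subst₂ _≤_ (sym (length-filter-upTo (λ r → any? (λ σ → σ % suc k ≟ r) L) (suc k)))
                             (sym (length-filter-upTo (λ r → any? (λ σ → σ % suc k ≟ r) (x ∷ L)) (suc k)))
                             (∑-mono-≤ (suc k) (λ r _ → hit-∷-mono r))
  where
  hit-∷-mono : ∀ r → χ (any? (λ σ → σ % suc k ≟ r) L) ≤ χ (any? (λ σ → σ % suc k ≟ r) (x ∷ L))
  hit-∷-mono r with x % suc k ≟ r | any? (λ σ → σ % suc k ≟ r) L
  ... | _ | no _ = z≤n
  ... | yes _ | yes _ = ≤-refl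
  ... | no _ | yes _ = ≤-refl

small⇒DistinctMod : ∀ k L → All (_< suc k) L → AllPairs _≢_ L → DistinctMod k L
small⇒DistinctMod k [] _ [] = []
small⇒DistinctMod k (x ∷ xs) (x<n ∷ xs<n) (x≢xs ∷ ≢xs) =
  All.zipWith (λ (x≢y , y<n) e → x≢y (trans (sym (m<n⇒m%n≡m x<n)) (trans e (m<n⇒m%n≡m y<n)))) (x≢xs , xs<n) ∷ small⇒DistinctMod k xs xs<n ≢xs

spans-bounds : ∀ L B → AllPairs _<_ L → All (_≤ B) L → ∀ {d} → d ∈ spansOf L → 1 ≤ d × d ≤ B
spans-bounds (x ∷ xs) B (x<xs ∷ <xs) (_ ∷ xs≤B) d∈ with ∈-++⁻ (map (λ y → y ∸ x) xs) d∈
... | inj₂ d∈′ = spans-bounds xs B <xs xs≤B d∈′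
... | inj₁ d∈′ with ∈-map⁻ (λ y → y ∸ x) d∈′
...   | y , y∈ , refl = m<n⇒0<n∸m (All.lookup x<xs y∈) , ≤-trans (m∸n≤m y x) (All.lookup xs≤B y∈)

spans-∤⇒DistinctMod : ∀ k L → AllPairs _<_ L → (∀ {d} → d ∈ spansOf L → ¬ suc k ∣ d) → DistinctMod k L
spans-∤⇒DistinctMod k [] [] _ = []
spans-∤⇒DistinctMod k (x ∷ xs) (x<xs ∷ <xs) ∤spans =
  head xs x<xs (λ d∈ → ∤spans (∈-++⁺ˡ d∈)) ∷ spans-∤⇒DistinctMod k xs <xs (λ d∈ → ∤spans (∈-++⁺ʳ (map (λ y → y ∸ x) xs) d∈))
  where
  head : ∀ ys → All (x <_) ys → (∀ {d} → d ∈ map (λ y → y ∸ x) ys → ¬ suc k ∣ d) → All (λ y → x % suc k ≢ y % suc k) ys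
  head [] _ _ = []
  head (y ∷ ys) (x<y ∷ x<ys) ∤ = (λ e → ∤ (here refl) (%≡%⇒∣∸ k y x (<⇒≤ x<y) (sym e))) ∷ head ys x<ys (λ d∈ → ∤ (there d∈))

spans-[] : ∀ s → length s ≡ 0 → ∀ {d} → d ∈ spans s → ⊥
spans-[] [] _ ()
spans-[] (_ ∷ _) () _

module Constellation (s : List ℕ) (pos : All (0 <_) s) where
  L = sigmas s
  J = length s
  c = suc J
  σ = sigmaJ s

  L-increasing : AllPairs _<_ L
  L-increasing = scanl-increasing 0 s pos

  L-unique : AllPairs _≢_ L
  L-unique = AllPairs.map <⇒≢ L-increasing

  L≤σ : All (_≤ σ) L
  L≤σ = sigmas≤sigmaJ s

  length-L : length L ≡ c
  length-L = length-scanl 0 s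

  QP? : ∀ q → Dec _
  QP? q = prime? q ×-dec ¬? (q ≟ 2) ×-dec any? (λ d → q ∣? d) (spans s)

  bQ : ℕ → Bool
  bQ i = does (QP? i)

  Qs≡∏ : Qs s ≡ ∏ (suc σ) bQ (λ i → i)
  Qs≡∏ = trans (cong product (sym (map-id (filter QP? (upTo (suc σ)))))) (product-filter-upTo QP? (λ i → i) (suc σ))

  bQ⇒Prime : ∀ i → bQ i ≡ true → Prime i
  bQ⇒Prime i e = primeᵇ⇒Prime (proj₁ (∧≡true⇒ {does (prime? i)} e))

  prime∣Qs⇒≤σ : ∀ {q} → Prime q → q ∣ Qs s → q < suc σ
  prime∣Qs⇒≤σ pq q∣Qs = prime∣∏⇒< (suc σ) bQ bQ⇒Prime pq (subst (_ ∣_) Qs≡∏ q∣Qs)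

  Qs-positive : 1 ≤ Qs s
  Qs-positive = subst (1 ≤_) (sym Qs≡∏) (∏-primes-positive (suc σ) bQ bQ⇒Prime)

  spans-bounds-s : ∀ {d} → d ∈ spans s → 1 ≤ d × d ≤ σ
  spans-bounds-s = spans-bounds L σ L-increasing L≤σ

  prime∣span⇒∣Qs : ∀ {q d} → Prime q → q ≢ 2 → d ∈ spans s → q ∣ d → q ∣ Qs s
  prime∣span⇒∣Qs {q} {d} pq q≢2 d∈ q∣d = subst (q ∣_) (sym Qs≡∏) (factor∣∏ (suc σ) bQ bQq (s≤s (≤-trans (∣⇒≤ {{d≢0}} q∣d) (proj₂ (spans-bounds-s d∈)))))
    where
    d≢0 : NonZero d
    d≢0 = >-nonZero (proj₁ (spans-bounds-s d∈))
    bQq : bQ q ≡ true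
    bQq rewrite dec-true (prime? q) pq | dec-false (q ≟ 2) q≢2 | dec-true (any? (λ d → q ∣? d) (spans s)) (Any.map (λ e → subst (q ∣_) e q∣d) d∈) = refl

  ν-coprime-Qs : ∀ k → Prime (suc k) → c < suc k → ¬ suc k ∣ Qs s → ν (suc k) L ≡ c
  ν-coprime-Qs k pq c<q q∤Qs = trans (ν-distinct k L (spans-∤⇒DistinctMod k L L-increasing q∤spans)) length-L
    where
    -- Q(s) omits the prime 2, but c < 2 forces J = 0, when there are no spans at all.
    q∤spans : ∀ {d} → d ∈ spansOf L → ¬ suc k ∣ d
    q∤spans d∈ q∣d with suc k ≟ 2
    ... | no q≢2 = q∤Qs (prime∣span⇒∣Qs pq q≢2 d∈ q∣d)
    ... | yes refl = spans-[] s (n≤0⇒n≡0 (≤-pred (≤-pred c<q))) d∈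

-- Convergence of w_{s,J}

-- For p ≥ σ_J, J + 1 the primes q ≤ p are q ≤ J + 1, q > J + 1 with q ∣ Q(s), and q > J + 1 with q ∤ Q(s);
-- on the last ones ν_q = J + 1, so their factors cancel between ∏ (q ∸ ν_q) and denomP.
module WInfRatio (s : List ℕ) (pos : All (0 <_) s) (p : ℕ) (σ≤p : sigmaJ s ≤ p) (c≤p : suc (length s) ≤ p) where
  open Constellation s pos

  q∸ν q∸c : ℕ → ℕ
  q∸ν q = q ∸ ν q L
  q∸c q = q ∸ c

  above-c divides-Q bigQ : ℕ → Bool
  above-c i = does (c <? i)
  divides-Q i = does (i ∣? Qs s)
  bigQ i = primeᵇ i ∧ (above-c i ∧ divides-Q i)

  bigQ⇒ : ∀ i → bigQ i ≡ true → Prime i × c < i × i ∣ Qs s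
  bigQ⇒ i e with ∧≡true⇒ {primeᵇ i} e
  ... | e₁ , e₂ with ∧≡true⇒ {above-c i} e₂
  ...   | e₃ , e₄ = primeᵇ⇒Prime e₁ , does≡true⇒ (c <? i) e₃ , does≡true⇒ (i ∣? Qs s) e₄

  bigQ<1+p : ∀ i → bigQ i ≡ true → i < suc p
  bigQ<1+p i e = let (pi , _ , i∣Q) = bigQ⇒ i e in ≤-trans (prime∣Qs⇒≤σ pi i∣Q) (s≤s σ≤p)

  bigQ<1+Q : ∀ i → bigQ i ≡ true → i < suc (Qs s)
  bigQ<1+Q i e = let (_ , _ , i∣Q) = bigQ⇒ i e in s≤s (∣⇒≤ {{>-nonZero Qs-positive}} i∣Q)

  bigQ? : ∀ q → Dec _
  bigQ? q = (c <? q) ×-dec (q ∣? Qs s)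

  ∏low≡ : product (map (λ q → q ∸ nu q s) (primesUpTo c)) ≡ ∏ (suc c) primeᵇ q∸ν
  ∏low≡ = product-nu≡∏ c s

  ∏bigQ≡ : product (map (λ q → q ∸ nu q s) (bigQPrimes s)) ≡ ∏ (suc p) bigQ q∸ν
  ∏bigQ≡ = trans (product-filter²-upTo bigQ? prime? (λ q → q ∸ nu q s) (suc (Qs s)))
             (trans (∏-range-irrelevant (suc (Qs s)) (suc p) bigQ _ bigQ<1+Q bigQ<1+p) (∏-cong (suc p) (λ _ _ → refl) (λ q _ _ → cong (q ∸_) (nu≡ν q s))))

  ∏bigQ[q∸c]≡ : product (map (λ q → q ∸ c) (bigQPrimes s)) ≡ ∏ (suc p) bigQ q∸c
  ∏bigQ[q∸c]≡ = trans (product-filter²-upTo bigQ? prime? q∸c (suc (Qs s))) (∏-range-irrelevant (suc (Qs s)) (suc p) bigQ q∸c bigQ<1+Q bigQ<1+p)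

  denomP≡ : denomP s p ≡ ∏ (suc p) (λ i → primeᵇ i ∧ above-c i) q∸c
  denomP≡ = product-filter²-upTo (c <?_) prime? q∸c (suc p)

  low-part : ∏ (suc p) (λ i → primeᵇ i ∧ not (above-c i)) q∸ν ≡ ∏ (suc c) primeᵇ q∸ν
  low-part = trans (∏-extend (suc c) (suc p) _ q∸ν i<1+c (s≤s c≤p))
    (∏-cong (suc c) (λ i i<1+c → trans (cong (λ z → primeᵇ i ∧ not z) (dec-false (c <? i) (λ c<i → <-irrefl refl (<-≤-trans c<i (≤-pred i<1+c))))) (∧-identityʳ (primeᵇ i)))
                    (λ _ _ _ → refl))
    where
    i<1+c : ∀ i → (primeᵇ i ∧ not (above-c i)) ≡ true → i < suc c
    i<1+c i e = s≤s (≮⇒≥ (does≡false⇒ (c <? i) (not≡true⇒ (proj₂ (∧≡true⇒ {primeᵇ i} e)))))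

  bigQ-part : ∀ f → ∏ (suc p) (λ i → (primeᵇ i ∧ above-c i) ∧ divides-Q i) f ≡ ∏ (suc p) bigQ f
  bigQ-part f = ∏-cong (suc p) (λ i _ → ∧-assoc (primeᵇ i) (above-c i) (divides-Q i)) (λ _ _ _ → refl)

  coprime-part : ∏ (suc p) (λ i → (primeᵇ i ∧ above-c i) ∧ not (divides-Q i)) q∸ν ≡ ∏ (suc p) (λ i → (primeᵇ i ∧ above-c i) ∧ not (divides-Q i)) q∸c
  coprime-part = ∏-cong (suc p) (λ _ _ → refl) factor≡
    where
    factor≡ : ∀ i → i < suc p → ((primeᵇ i ∧ above-c i) ∧ not (divides-Q i)) ≡ true → q∸ν i ≡ q∸c i
    factor≡ zero _ _ = refl
    factor≡ (suc k) _ e with ∧≡true⇒ {primeᵇ (suc k) ∧ above-c (suc k)} e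
    ... | e₁ , e₂ with ∧≡true⇒ {primeᵇ (suc k)} e₁
    ...   | e₃ , e₄ = cong (suc k ∸_) (ν-coprime-Qs k (primeᵇ⇒Prime e₃) (does≡true⇒ (c <? suc k) e₄) (does≡false⇒ (suc k ∣? Qs s) (not≡true⇒ e₂)))

  wInf-cross-multiplied : ∏ (suc p) primeᵇ q∸ν * product (map (λ q → q ∸ c) (bigQPrimes s))
        ≡ (product (map (λ q → q ∸ nu q s) (primesUpTo c)) * product (map (λ q → q ∸ nu q s) (bigQPrimes s))) * denomP s p
  wInf-cross-multiplied = begin
      ∏ (suc p) primeᵇ q∸ν * product (map (λ q → q ∸ c) (bigQPrimes s))
    ≡⟨ cong₂ _*_ (trans (∏-split (suc p) primeᵇ above-c q∸ν)
                   (cong₂ _*_ (trans (∏-split (suc p) (λ i → primeᵇ i ∧ above-c i) divides-Q q∸ν) (cong₂ _*_ (bigQ-part q∸ν) coprime-part)) low-part))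
                 ∏bigQ[q∸c]≡ ⟩
      B * C * A * B′
    ≡⟨ solve 4 (λ a b c b′ → b :* c :* a :* b′ := a :* b :* (b′ :* c)) refl A B C B′ ⟩
      A * B * (B′ * C)
    ≡⟨ sym (cong₂ _*_ (cong₂ _*_ ∏low≡ ∏bigQ≡) (trans denomP≡ (trans (∏-split (suc p) (λ i → primeᵇ i ∧ above-c i) divides-Q q∸c) (cong (_* C) (bigQ-part q∸c))))) ⟩
      (product (map (λ q → q ∸ nu q s) (primesUpTo c)) * product (map (λ q → q ∸ nu q s) (bigQPrimes s))) * denomP s p
    ∎
    where
    open ≡-Reasoning
    A = ∏ (suc c) primeᵇ q∸ν
    B = ∏ (suc p) bigQ q∸ν
    B′ = ∏ (suc p) bigQ q∸c
    C = ∏ (suc p) (λ i → (primeᵇ i ∧ above-c i) ∧ not (divides-Q i)) q∸c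

private
  [q-c-1]q≤[q-c][q-1]-shifted : ∀ c r → (suc c + r ∸ suc c) * (suc c + r) ≤ (suc c + r ∸ c) * (suc c + r ∸ 1)
  [q-c-1]q≤[q-c][q-1]-shifted c r rewrite m+n∸m≡n (suc c) r | sym (+-suc c r) | m+n∸m≡n c (suc r) | +-suc c r =
    ≤-trans (m≤m+n (r * suc (c + r)) c) (≤-reflexive (solve 2 (λ c r → r :* (con 1 :+ (c :+ r)) :+ c := (con 1 :+ r) :* (c :+ r)) refl c r))

[q-c-1]q≤[q-c][q-1] : ∀ q c → (q ∸ suc c) * q ≤ (q ∸ c) * (q ∸ 1)
[q-c-1]q≤[q-c][q-1] q c with suc c ≤? q
... | yes le = subst (λ z → (z ∸ suc c) * z ≤ (z ∸ c) * (z ∸ 1)) (m+[n∸m]≡n le) ([q-c-1]q≤[q-c][q-1]-shifted c (q ∸ suc c))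
... | no nle rewrite m≤n⇒m∸n≡0 (<⇒≤ (≰⇒> nle)) = z≤n

-- T counts the driving terms for s of all lengths, N those of length J, i.e. the occurrences of s.
module Deficit (s : List ℕ) (pos : All (0 <_) s) (p : ℕ) (σ≤p : sigmaJ s ≤ p) where
  open Constellation s pos

  P = primorial p
  N = nsj s J p
  T = occurrences P L

  q∸ν : ℕ → ℕ
  q∸ν q = q ∸ ν q L

  small smallPrime largePrime : ℕ → Bool
  small i = does (i ≤? σ)
  smallPrime i = primeᵇ i ∧ small i
  largePrime i = primeᵇ i ∧ not (small i)

  largePrime⇒ : ∀ i → largePrime i ≡ true → Prime i × σ < i
  largePrime⇒ i e with ∧≡true⇒ {primeᵇ i} e
  ... | e₁ , e₂ = primeᵇ⇒Prime e₁ , ≰⇒> (does≡false⇒ (i ≤? σ) (not≡true⇒ e₂))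

  extraAt : ℕ → ℕ → ℕ
  extraAt γ k = χ (0 <? k) * (χ (¬? (k ∈? L)) * χ (coprime? (γ + k) P))

  extra≡∑ : ∀ γ → extra p s γ ≡ ∑ σ (extraAt γ)
  extra≡∑ γ = trans (length-filter-upTo _ σ) (∑-cong σ (λ k _ →
    trans (χ-× (0 <? k) (¬? (k ∈? L) ×-dec coprime? (γ + k) P)) (cong (χ (0 <? k) *_) (χ-× (¬? (k ∈? L)) (coprime? (γ + k) P)))))

  N≤T : N ≤ T
  N≤T = subst (_≤ T) (sym (nsj≡∑ s J p))
    (∑-mono-≤ P (λ γ _ → ≤-trans (*-monoʳ-≤ (coprimeAt P L γ) (χ≤1 (J + extra p s γ ≟ J))) (≤-reflexive (*-identityʳ _))))

  T≤N+∑extra : T ≤ N + (∑[ γ < P ] coprimeAt P L γ * extra p s γ)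
  T≤N+∑extra = subst (T ≤_) (sym (cong (_+ (∑[ γ < P ] coprimeAt P L γ * extra p s γ)) (nsj≡∑ s J p)))
    (≤-trans (∑-mono-≤ P (λ γ _ → term≤ γ)) (≤-reflexive (∑-distrib-+ P _ _)))
    where
    term≤ : ∀ γ → coprimeAt P L γ ≤ coprimeAt P L γ * χ (J + extra p s γ ≟ J) + coprimeAt P L γ * extra p s γ
    term≤ γ with extra p s γ
    ... | zero rewrite χ-yes (J + 0 ≟ J) (+-identityʳ J) | *-identityʳ (coprimeAt P L γ) = m≤m+n _ _
    ... | suc _ = ≤-trans (≤-reflexive (sym (*-identityʳ _))) (≤-trans (*-monoʳ-≤ (coprimeAt P L γ) (s≤s z≤n)) (m≤n+m _ _))

  coprimeAt-∷ : ∀ γ k → χ (coprime? (γ + k) P) * coprimeAt P L γ ≡ coprimeAt P (k ∷ L) γ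
  coprimeAt-∷ γ k = trans (sym (χ-× (coprime? (γ + k) P) (all? (λ σ → coprime? (γ + σ) P) L)))
                          (χ-cong (λ (c , cs) → c ∷ cs) (λ { (c ∷ cs) → c , cs }) _ _)

  -- An extra coprime γ + k inside an occurrence is an occurrence of the longer pattern k ∷ L.
  ∑extra≤ : ∑[ γ < P ] coprimeAt P L γ * extra p s γ ≤ ∑[ k < σ ] χ (¬? (k ∈? L)) * occurrences P (k ∷ L)
  ∑extra≤ = begin
      ∑[ γ < P ] coprimeAt P L γ * extra p s γ
    ≡⟨ ∑-cong P (λ γ _ → trans (cong (coprimeAt P L γ *_) (extra≡∑ γ)) (sym (∑-*ˡ σ (coprimeAt P L γ) (extraAt γ)))) ⟩
      ∑[ γ < P ] ∑[ k < σ ] coprimeAt P L γ * extraAt γ k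
    ≡⟨ ∑-comm P σ _ ⟩
      ∑[ k < σ ] ∑[ γ < P ] coprimeAt P L γ * extraAt γ k
    ≤⟨ ∑-mono-≤ σ (λ k _ → ∑-mono-≤ P (λ γ _ → term≤ γ k)) ⟩
      ∑[ k < σ ] ∑[ γ < P ] χ (¬? (k ∈? L)) * coprimeAt P (k ∷ L) γ
    ≡⟨ ∑-cong σ (λ k _ → ∑-*ˡ P (χ (¬? (k ∈? L))) _) ⟩
      ∑[ k < σ ] χ (¬? (k ∈? L)) * occurrences P (k ∷ L)
    ∎
    where
    open ≤-Reasoning
    term≤ : ∀ γ k → coprimeAt P L γ * extraAt γ k ≤ χ (¬? (k ∈? L)) * coprimeAt P (k ∷ L) γ
    term≤ γ k = begin
        u * (χ (0 <? k) * (v * w))   ≤⟨ *-monoʳ-≤ u (*-monoˡ-≤ _ (χ≤1 (0 <? k))) ⟩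
        u * (1 * (v * w))            ≡⟨ solve 3 (λ u v w → u :* (con 1 :* (v :* w)) := v :* (w :* u)) refl u v w ⟩
        v * (w * u)                  ≡⟨ cong (v *_) (coprimeAt-∷ γ k) ⟩
        v * coprimeAt P (k ∷ L) γ    ∎
      where
      u = coprimeAt P L γ
      v = χ (¬? (k ∈? L))
      w = χ (coprime? (γ + k) P)

  -- Splitting the primes q ≤ p into small (q ≤ σ) and large ones, T = X · E and each occurrences P (k ∷ L) ≤ X · F.
  X X₁ E F R₁ R Pσ : ℕ
  X = ∏ (suc p) smallPrime q∸ν
  X₁ = ∏ (suc p) smallPrime (λ q → q ∸ 1)
  E = ∏ (suc p) largePrime (λ q → q ∸ c)
  F = ∏ (suc p) largePrime (λ q → q ∸ suc c)
  R₁ = ∏ (suc p) largePrime (λ q → q ∸ 1)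
  R = ∏ (suc p) largePrime (λ q → q)
  Pσ = primorial< (suc σ)

  L< : ∀ {i} → σ < i → All (_< i) L
  L< σ<i = All.map (λ x≤σ → ≤-<-trans x≤σ σ<i) L≤σ

  T≡X*E : T ≡ X * E
  T≡X*E = trans (occurrences-primorial p L) (trans (∏-split (suc p) primeᵇ small q∸ν) (cong (X *_) (∏-cong (suc p) (λ _ _ → refl) large-factor≡)))
    where
    large-factor≡ : ∀ i → i < suc p → largePrime i ≡ true → q∸ν i ≡ i ∸ c
    large-factor≡ zero _ _ = refl
    large-factor≡ (suc i) _ e with largePrime⇒ (suc i) e
    ... | _ , σ<i = cong (suc i ∸_) (trans (ν-distinct i L (small⇒DistinctMod i L (L< σ<i) L-unique)) length-L)

  occurrences-∷≤X*F : ∀ k → k < σ → χ (¬? (k ∈? L)) * occurrences P (k ∷ L) ≤ X * F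
  occurrences-∷≤X*F k k<σ with k ∈? L
  ... | yes _ = z≤n
  ... | no k∉L = subst (_≤ X * F) (sym (+-identityʳ _)) (begin
      occurrences P (k ∷ L)
    ≡⟨ occurrences-primorial p (k ∷ L) ⟩
      ∏ (suc p) primeᵇ (λ q → q ∸ ν q (k ∷ L))
    ≡⟨ ∏-split (suc p) primeᵇ small _ ⟩
      ∏ (suc p) smallPrime (λ q → q ∸ ν q (k ∷ L)) * ∏ (suc p) largePrime (λ q → q ∸ ν q (k ∷ L))
    ≤⟨ *-mono-≤ (∏-mono-≤ (suc p) smallPrime small-factor≤) (≤-reflexive (∏-cong (suc p) (λ _ _ → refl) large-factor≡)) ⟩
      X * F
    ∎)
    where
    open ≤-Reasoning
    small-factor≤ : ∀ i → i < suc p → smallPrime i ≡ true → i ∸ ν i (k ∷ L) ≤ q∸ν i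
    small-factor≤ zero _ _ = ≤-refl
    small-factor≤ (suc i) _ _ = ∸-monoʳ-≤ (suc i) (ν-∷-mono i k L)
    large-factor≡ : ∀ i → i < suc p → largePrime i ≡ true → i ∸ ν i (k ∷ L) ≡ i ∸ suc c
    large-factor≡ zero _ _ = refl
    large-factor≡ (suc i) _ e with largePrime⇒ (suc i) e
    ... | _ , σ<i = cong (suc i ∸_) (trans (ν-distinct i (k ∷ L)
                      (small⇒DistinctMod i (k ∷ L) (<-trans k<σ σ<i ∷ L< σ<i) (¬Any⇒All¬ L k∉L ∷ L-unique))) (cong suc length-L))

  T∸N≤σXF : T ∸ N ≤ σ * (X * F)
  T∸N≤σXF = begin
      T ∸ N                                                  ≤⟨ ∸-monoˡ-≤ N T≤N+∑extra ⟩
      N + (∑[ γ < P ] coprimeAt P L γ * extra p s γ) ∸ N     ≡⟨ m+n∸m≡n N _ ⟩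
      ∑[ γ < P ] coprimeAt P L γ * extra p s γ               ≤⟨ ∑extra≤ ⟩
      ∑[ k < σ ] χ (¬? (k ∈? L)) * occurrences P (k ∷ L)     ≤⟨ ∑-mono-≤ σ occurrences-∷≤X*F ⟩
      ∑[ _ < σ ] X * F                                       ≡⟨ ∑-const σ (X * F) ⟩
      σ * (X * F)                                            ∎
    where open ≤-Reasoning

  ∏smallPrimes≡Pσ : ∏ (suc p) smallPrime (λ q → q) ≡ Pσ
  ∏smallPrimes≡Pσ = trans (∏-extend (suc σ) (suc p) smallPrime (λ q → q) i<1+σ (s≤s σ≤p))
    (∏-cong (suc σ) (λ i i<1+σ → trans (cong (primeᵇ i ∧_) (dec-true (i ≤? σ) (≤-pred i<1+σ))) (∧-identityʳ (primeᵇ i))) (λ _ _ _ → refl))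
    where
    i<1+σ : ∀ i → smallPrime i ≡ true → i < suc σ
    i<1+σ i e = s≤s (does≡true⇒ (i ≤? σ) (proj₂ (∧≡true⇒ {primeᵇ i} e)))

  R-positive : 1 ≤ R
  R-positive = ∏-primes-positive (suc p) largePrime (λ i e → proj₁ (largePrime⇒ i e))

  X₁-positive : 1 ≤ X₁
  X₁-positive = ∏-positive (suc p) smallPrime (λ q → q ∸ 1) (λ i e → ∸-monoˡ-≤ {2} {i} 1 (prime⇒≥2 (primeᵇ⇒Prime {i} (proj₁ (∧≡true⇒ {primeᵇ i} e)))))

  F*R≤E*R₁ : F * R ≤ E * R₁
  F*R≤E*R₁ = subst₂ _≤_ (∏-distrib-* (suc p) largePrime (λ q → q ∸ suc c) (λ q → q)) (∏-distrib-* (suc p) largePrime (λ q → q ∸ c) (λ q → q ∸ 1))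
    (∏-mono-≤ (suc p) largePrime (λ i _ _ → [q-c-1]q≤[q-c][q-1] i c))

  euler-large : ∀ m → 2 ^ m ≤ p → (m + 2) * R₁ ≤ 2 * (Pσ * R)
  euler-large m 2^m≤p = begin
      (m + 2) * R₁                      ≤⟨ *-monoʳ-≤ (m + 2) (m≤n*m R₁ X₁ {{>-nonZero X₁-positive}}) ⟩
      (m + 2) * (X₁ * R₁)               ≡⟨ cong ((m + 2) *_) (sym (∏-split (suc p) primeᵇ small (λ q → q ∸ 1))) ⟩
      (m + 2) * ∏primes[q-1] (suc p)    ≤⟨ ∏primes[q-1]-bound m p 2^m≤p ⟩
      2 * ∏primes (suc p)               ≡⟨ cong (2 *_) (trans (∏-split (suc p) primeᵇ small (λ q → q)) (cong (_* R) ∏smallPrimes≡Pσ)) ⟩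
      2 * (Pσ * R)                      ∎
    where open ≤-Reasoning

  deficit-bound : ∀ m → 2 ^ m ≤ p → (T ∸ N) * (m + 2) ≤ (2 * σ * Pσ) * T
  deficit-bound m 2^m≤p = *-cancelʳ-≤ ((T ∸ N) * (m + 2)) ((2 * σ * Pσ) * T) R {{>-nonZero R-positive}} (begin
      (T ∸ N) * (m + 2) * R                 ≤⟨ *-monoˡ-≤ R (*-monoˡ-≤ (m + 2) T∸N≤σXF) ⟩
      σ * (X * F) * (m + 2) * R             ≡⟨ solve 5 (λ σ x f m r → σ :* (x :* f) :* m :* r := σ :* x :* m :* (f :* r)) refl σ X F (m + 2) R ⟩
      σ * X * (m + 2) * (F * R)             ≤⟨ *-monoʳ-≤ (σ * X * (m + 2)) F*R≤E*R₁ ⟩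
      σ * X * (m + 2) * (E * R₁)            ≡⟨ solve 5 (λ σ x m e r₁ → σ :* x :* m :* (e :* r₁) := σ :* x :* e :* (m :* r₁)) refl σ X (m + 2) E R₁ ⟩
      σ * X * E * ((m + 2) * R₁)            ≤⟨ *-monoʳ-≤ (σ * X * E) (euler-large m 2^m≤p) ⟩
      σ * X * E * (2 * (Pσ * R))            ≡⟨ solve 5 (λ σ x e π r → σ :* x :* e :* (con 2 :* (π :* r)) := con 2 :* σ :* π :* (x :* e) :* r) refl σ X E Pσ R ⟩
      (2 * σ * Pσ) * (X * E) * R            ≡⟨ cong (λ z → (2 * σ * Pσ) * z * R) (sym T≡X*E) ⟩
      (2 * σ * Pσ) * T * R                  ∎)
    where open ≤-Reasoning

private
  ∣-+n∣≡n : ∀ n → ℤ.∣ ℤ.- (ℤ.+ n) ∣ ≡ n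
  ∣-+n∣≡n zero = refl
  ∣-+n∣≡n (suc n) = refl

  ∣frac-frac∣<-suc : ∀ N T D′ num d′ nε dε .(c : Coprime (suc nε) (suc dε)) → N ≤ T → T * suc d′ ≡ num * suc D′ →
    (T ∸ N) * suc dε < suc nε * suc D′ →
    ∣ frac N (suc D′) - frac num (suc d′) ∣ <ℚ mkℚ +[1+ nε ] dε c
  ∣frac-frac∣<-suc N T D′ num d′ nε dε c N≤T cross deficit = toℚᵘ-cancel-< (<-respˡ-≃ (≃-sym toℚᵘ-∣x-y∣) ∣u-v∣<ε)
    where
    open Data.Integer using (+_)
    u = mkℚᵘ (+ N) D′
    v = mkℚᵘ (+ num) d′
    x = fromℚᵘ u
    y = fromℚᵘ v
    toℚᵘ-∣x-y∣ : toℚᵘ (∣ x - y ∣) ℚᵘ.≃ ℚᵘ.∣ u ℚᵘ.+ (ℚᵘ.- v) ∣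
    toℚᵘ-∣x-y∣ = ≃-trans (toℚᵘ-homo-∣-∣ (x - y)) (∣-∣-cong (≃-trans (toℚᵘ-homo-+ x (ℚ.- y)) (+-cong (toℚᵘ-fromℚᵘ u) (≃-trans (toℚᵘ-homo‿- y) (-‿cong (toℚᵘ-fromℚᵘ v))))))
    a = N * suc d′
    b = num * suc D′
    a≤b : a ≤ b
    a≤b = subst (a ≤_) cross (*-monoˡ-≤ (suc d′) N≤T)
    b∸a : b ∸ a ≡ (T ∸ N) * suc d′
    b∸a = trans (cong (_∸ a) (sym cross)) (sym (*-distribʳ-∸ (suc d′) T N))
    ∣numerator∣ : ℤ.∣ + N ℤ.* + suc d′ ℤ.+ ℤ.- (+ num) ℤ.* + suc D′ ∣ ≡ b ∸ a
    ∣numerator∣ = begin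
        ℤ.∣ + N ℤ.* + suc d′ ℤ.+ (ℤ.- (+ num)) ℤ.* + suc D′ ∣
      ≡⟨ cong₂ (λ i j → ℤ.∣ i ℤ.+ j ∣) (sym (pos-* N (suc d′))) (trans (sym (ℤP.neg-distribˡ-* (+ num) (+ suc D′))) (cong ℤ.-_ (sym (pos-* num (suc D′))))) ⟩
        ℤ.∣ + a ℤ.+ ℤ.- (+ b) ∣
      ≡⟨ cong ℤ.∣_∣ (trans (m-n≡m⊖n a b) (⊖-≤ a≤b)) ⟩
        ℤ.∣ ℤ.- (+ (b ∸ a)) ∣
      ≡⟨ ∣-+n∣≡n (b ∸ a) ⟩
        b ∸ a
      ∎
      where open ≡-Reasoning
    [b∸a]ε′<nεD′d′ : (b ∸ a) * suc dε < suc nε * (suc D′ * suc d′)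
    [b∸a]ε′<nεD′d′ = subst₂ _<_
      (trans (solve 3 (λ x y z → x :* y :* z := x :* z :* y) refl (T ∸ N) (suc dε) (suc d′)) (cong (_* suc dε) (sym b∸a)))
      (solve 3 (λ x y z → x :* y :* z := x :* (y :* z)) refl (suc nε) (suc D′) (suc d′))
      (*-monoˡ-< (suc d′) deficit)
    ∣u-v∣<ε : ℚᵘ.∣ u ℚᵘ.+ (ℚᵘ.- v) ∣ ℚᵘ.< mkℚᵘ +[1+ nε ] dε
    ∣u-v∣<ε = *<* (subst (λ z → + z ℤ.* + suc dε ℤ.< +[1+ nε ] ℤ.* + (suc D′ * suc d′)) (sym ∣numerator∣)
                    (subst₂ ℤ._<_ (pos-* (b ∸ a) (suc dε)) (pos-* (suc nε) (suc D′ * suc d′)) (ℤ.+<+ [b∸a]ε′<nεD′d′)))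

-- When num/den = T/D, the distance |N/D − num/den| is (T − N)/D.
∣frac-frac∣< : ∀ N T D num den nε dε .(c : Coprime (suc nε) (suc dε)) → 1 ≤ D → 1 ≤ den → N ≤ T → T * den ≡ num * D →
  (T ∸ N) * suc dε < suc nε * D → ∣ frac N D - frac num den ∣ <ℚ mkℚ +[1+ nε ] dε c
∣frac-frac∣< N T (suc D′) num (suc d′) nε dε c _ _ = ∣frac-frac∣<-suc N T D′ num d′ nε dε c

deficit-small : ∀ T N K num D den dε nε m → m ≡ K * num * suc dε → 1 ≤ D → 1 ≤ den →
  (T ∸ N) * (m + 2) ≤ K * T → T * den ≡ num * D → (T ∸ N) * suc dε < suc nε * D
deficit-small T N K num D den dε nε m m≡ D≥1 den≥1 deficit cross with (T ∸ N) * suc dε <? suc nε * D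
... | yes small = small
... | no ¬small = contradiction D[m+2]den≤mD (<⇒≱ mD<D[m+2]den)
  where
  open ≤-Reasoning
  Y = T ∸ N
  ε′ = suc dε
  mD<D[m+2]den : m * D < D * (m + 2) * den
  mD<D[m+2]den = begin-strict
      m * D              <⟨ *-monoˡ-< D {{>-nonZero D≥1}} (m<m+n m {2} (s≤s z≤n)) ⟩
      (m + 2) * D        ≡⟨ *-comm (m + 2) D ⟩
      D * (m + 2)        ≤⟨ m≤m*n (D * (m + 2)) den {{>-nonZero den≥1}} ⟩
      D * (m + 2) * den  ∎
  D[m+2]den≤mD : D * (m + 2) * den ≤ m * D
  D[m+2]den≤mD = begin
      D * (m + 2) * den             ≤⟨ *-monoˡ-≤ den (*-monoˡ-≤ (m + 2) (m≤n*m D (suc nε))) ⟩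
      suc nε * D * (m + 2) * den    ≤⟨ *-monoˡ-≤ den (*-monoˡ-≤ (m + 2) (≮⇒≥ ¬small)) ⟩
      Y * ε′ * (m + 2) * den        ≡⟨ solve 4 (λ y e m d → y :* e :* m :* d := e :* d :* (y :* m)) refl Y ε′ (m + 2) den ⟩
      ε′ * den * (Y * (m + 2))      ≤⟨ *-monoʳ-≤ (ε′ * den) deficit ⟩
      ε′ * den * (K * T)            ≡⟨ solve 4 (λ e d k t → e :* d :* (k :* t) := k :* e :* (t :* d)) refl ε′ den K T ⟩
      K * ε′ * (T * den)            ≡⟨ cong (K * ε′ *_) cross ⟩
      K * ε′ * (num * D)            ≡⟨ solve 4 (λ k e n d → k :* e :* (n :* d) := k :* n :* e :* d) refl K ε′ num D ⟩
      K * num * ε′ * D              ≡⟨ cong (_* D) (sym m≡) ⟩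
      m * D                         ∎

-- Once 2 ^ m ≤ p, the deficit bound gives |w_{s,J}(p#) − w_{s,J}(∞)| ≤ K · (num/den)/(m + 2), and m is chosen
-- to make this smaller than ε = (1 + nε)/(1 + dε).
module Convergence (s : List ℕ) (pos : All (0 <_) s) (nε dε : ℕ) .(cε : Coprime (suc nε) (suc dε)) where
  σ = sigmaJ s
  c = suc (length s)
  K = 2 * σ * primorial< (suc σ)
  num = product (map (λ q → q ∸ nu q s) (primesUpTo c)) * product (map (λ q → q ∸ nu q s) (bigQPrimes s))
  den = product (map (λ q → q ∸ c) (bigQPrimes s))
  m = K * num * suc dε
  P₀ = 2 ^ m + σ + c

  wsJ-close : ∀ p → P₀ ≤ p → ∣ wsJ s p - wInf s ∣ <ℚ mkℚ +[1+ nε ] dε cε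
  wsJ-close p P₀≤p = ∣frac-frac∣< D.N D.T (denomP s p) num den nε dε cε denomP-positive den-positive D.N≤T cross
    (deficit-small D.T D.N K num (denomP s p) den dε nε m refl denomP-positive den-positive (D.deficit-bound m 2^m≤p) cross)
    where
    2^m≤p : 2 ^ m ≤ p
    2^m≤p = ≤-trans (≤-trans (m≤m+n (2 ^ m) σ) (m≤m+n (2 ^ m + σ) c)) P₀≤p
    σ≤p : σ ≤ p
    σ≤p = ≤-trans (≤-trans (m≤n+m σ (2 ^ m)) (m≤m+n (2 ^ m + σ) c)) P₀≤p
    c≤p : c ≤ p
    c≤p = ≤-trans (m≤n+m c (2 ^ m + σ)) P₀≤p
    module D = Deficit s pos p σ≤p
    module W = WInfRatio s pos p σ≤p c≤p
    cross : D.T * den ≡ num * denomP s p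
    cross = trans (cong (_* den) (occurrences-primorial p (sigmas s))) W.wInf-cross-multiplied
    denomP-positive : 1 ≤ denomP s p
    denomP-positive = subst (1 ≤_) (sym W.denomP≡)
      (∏-positive (suc p) (λ i → primeᵇ i ∧ W.above-c i) W.q∸c (λ i e → m<n⇒0<n∸m (does≡true⇒ (c <? i) (proj₂ (∧≡true⇒ {primeᵇ i} e)))))
    den-positive : 1 ≤ den
    den-positive = subst (1 ≤_) (sym W.∏bigQ[q∸c]≡) (∏-positive (suc p) W.bigQ W.q∸c (λ i e → m<n⇒0<n∸m (proj₁ (proj₂ (W.bigQ⇒ i e)))))

wsJ-converges : ∀ s → All (0 <_) s → (ε : ℚ) → ℚ.Positive ε → ∃[ P ] ((p : ℕ) → Prime p → P ≤ p → ∣ wsJ s p - wInf s ∣ <ℚ ε)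
wsJ-converges s pos (mkℚ +[1+ nε ] dε c) _ = Convergence.P₀ s pos nε dε c , λ p _ → Convergence.wsJ-close s pos nε dε c p

corollary2 : (s : List ℕ) → All (0 <_) s → Admissible s →
    ((p : ℕ) → Prime p →
    sumDriving s p ≡ product (map (λ q → q ∸ nu q s) (primesUpTo p)))
    × ((ε : ℚ) → 0ℚ <ℚ ε →
    ∃[ P ] ((p : ℕ) → Prime p → P ≤ p → ∣ wsJ s p - wInf s ∣ <ℚ ε))
corollary2 s pos _ = (λ p _ → sumDriving≡∏ s p) , (λ ε ε>0 → wsJ-converges s pos ε (positive ε>0))
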